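{- Let $\mathrm{FQSym}^{(\mathbb{N}^*)}$ be the algebra with basis $\mathbf{F}_{\sigma,I}$, $\sigma\in\mathfrak{S}_n$, $I\in(\mathbb{N}^*)^n$ ($n\ge 0$), with product $\mathbf{F}_{\sigma',c'}\mathbf{F}_{\sigma'',c''}=\sum\mathbf{F}_{\sigma,c}$, summed over all colored permutations $(\sigma,c)$ obtained by shuffling the word of colored letters $(\sigma'_1,c'_1)\cdots(\sigma'_n,c'_n)$ with the word $(\sigma''_1+n,c''_1)\cdots(\sigma''_m+n,c''_m)$, where $\sigma'\in\mathfrak{S}_n$, $\sigma''\in\mathfrak{S}_m$. Define a basis $\mathbf{Z}_{\sigma,J}$ by $$\mathbf{F}_{\sigma,I}=\sum_{|J|=|I|}c_{IJ}\,\mathbf{Z}_{\sigma,J}$$ for $\sigma\in\mathfrak{S}_n$ and $I$ a composition of length $n$ (sum over compositions $J$ of length $n$ with $|J|=|I|$). Then for $\sigma'\in\mathfrak{S}_n$, $\sigma''\in\mathfrak{S}_m$ and compositions $J',J''$ of lengths $n,m$, $$\mathbf{Z}_{\sigma',J'}\mathbf{Z}_{\sigma'',J''}=\sum_{\sigma,J}\langle\epsilon_{\sigma,J}\mid\epsilon_{\sigma',J'}\,\sqcup\!\sqcup\,\epsilon_{\sigma''[n],J''}\rangle\,\mathbf{Z}_{\sigma,J},$$ the sum over $\sigma\in\mathfrak{S}_{n+m}$ and compositions $J$ of length $n+m$.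
   Context: $\mathbb{K}$ is a field of characteristic $0$ and $\mathbb{N}^*$ the positive integers; an element $I\in(\mathbb{N}^*)^n$ is identified with a composition of length $n$, and $|I|$ is the sum of its parts. For compositions $I=(i_1,\dots,i_k)$, $J=(j_1,\dots,j_k)$ of the same length and the same sum, $c_{IJ}=\prod_{s=1}^k\binom{j_1+\cdots+j_s-(i_1+\cdots+i_{s-1})-1}{i_s-1}$ (equivalently, the number of set partitions of $[|I|]$ whose blocks, ordered by increasing maxima $m_1<\dots<m_k$, have sizes $i_1,\dots,i_k$ and maxima $m_s=j_1+\cdots+j_s$). For $\sigma\in\mathfrak{S}_n$ and a composition $s=(s_1,\dots,s_n)$, $\epsilon_{\sigma,s}$ is the word $0^{s_1-1}\sigma(1)\,0^{s_2-1}\sigma(2)\cdots0^{s_n-1}\sigma(n)$ over the alphabet $\{0,1,2,\dots\}$. $\sigma''[n]$ denotes $\sigma''$ with every value shifted by $n$. $\sqcup\!\sqcup$ is the shuffle of words and $\langle w\mid P\rangle$ is the coefficient of the word $w$ in $P$. -}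

module Defs where

open import Level using (Level; _⊔_) renaming (suc to lsuc)
open import Data.Nat using (ℕ; zero; suc; _+_; _*_; _∸_; _≤_; _≟_)
open import Data.Nat.Combinatorics using (_C_)
open import Data.Fin using (Fin; toℕ)
import Data.Fin as Fin
open import Data.Product using (Σ; _×_; _,_)
import Data.Product.Properties as ×P
open import Data.List using (List; []; _∷_; _++_; map; concatMap; concat; filter; length; foldr; upTo; allFin)
import Data.List.Properties as LP
open import Data.Vec using (Vec; toList; zipWith) renaming ([] to []ᵥ; _∷_ to _∷ᵥ_; sum to sumᵥ; map to mapᵥ)
open import Data.Vec.Relation.Unary.All using (All)
open import Relation.Nullary using (¬_; yes; no)
open import Relation.Binary.PropositionalEquality using (_≡_)
open import Algebra.Bundles using (CommutativeRing)
import Data.List.Relation.Unary.Unique.DecPropositional as UniqueDec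

record Field (c ℓ : Level) : Set (lsuc (c ⊔ ℓ)) where
  field
    commutativeRing : CommutativeRing c ℓ
  open CommutativeRing commutativeRing
    using (Carrier; _≈_; 0#; 1#) renaming (_*_ to _*ᴷ_)
  field
    0≉1     : ¬ (0# ≈ 1#)
    inverse : ∀ x → ¬ (x ≈ 0#) → Σ Carrier (λ y → (x *ᴷ y) ≈ 1#)

-- all shuffles of two words (as a list, i.e. a multiset with multiplicities)
shuffles : {A : Set} → List A → List A → List (List A)
shuffles []       ys       = ys ∷ []
shuffles (x ∷ xs) []       = (x ∷ xs) ∷ []
shuffles (x ∷ xs) (y ∷ ys) =
  map (x ∷_) (shuffles xs (y ∷ ys)) ++ map (y ∷_) (shuffles (x ∷ xs) ys)

vecs : {A : Set} → (k : ℕ) → List A → List (Vec A k)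
vecs zero    xs = []ᵥ ∷ []
vecs (suc k) xs = concatMap (λ x → map (x ∷ᵥ_) (vecs k xs)) xs

-- number of occurrences of a word w in a list of words
-- (coefficient ⟨ w ∣ P ⟩ of a sum P of words with coefficients in ℕ)
occ : List ℕ → List (List ℕ) → ℕ
occ w P = length (filter (LP.≡-dec _≟_ w) P)

-- Permutations in one-line notation (values 0..n-1, i.e. σ(i) = 1 + toℕ (σ i))
-- and compositions.


IsPerm : {n : ℕ} → Vec (Fin n) n → Set
IsPerm {n} σ = UniqueDec.Unique (Fin._≟_ {n}) (toList σ)

perms : (n : ℕ) → List (Vec (Fin n) n)
perms n = filter (λ σ → UniqueDec.unique? (Fin._≟_ {n}) (toList σ)) (vecs n (allFin n))

IsComp : {k : ℕ} → Vec ℕ k → Set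
IsComp = All (λ x → 1 ≤ x)

comps : (k d : ℕ) → List (Vec ℕ k)
comps k d = filter (λ J → sumᵥ J ≟ d) (vecs k (map suc (upTo d)))

-- the coefficient c_{IJ} = ∏_s binom(j_1+…+j_s − (i_1+…+i_{s−1}) − 1, i_s − 1)
cAux : {k : ℕ} → ℕ → ℕ → Vec ℕ k → Vec ℕ k → ℕ
cAux pI pJ []ᵥ       []ᵥ       = 1
cAux pI pJ (i ∷ᵥ I) (j ∷ᵥ J) =
  (((pJ + j) ∸ pI ∸ 1) C (i ∸ 1)) * cAux (pI + i) (pJ + j) I J

cIJ : {k : ℕ} → Vec ℕ k → Vec ℕ k → ℕ
cIJ = cAux 0 0

-- letters of σ (as 1..n) and of σ[n] (shifted by n)
letters : {n : ℕ} → Vec (Fin n) n → Vec ℕ n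
letters = mapᵥ (λ x → suc (toℕ x))

shiftLetters : {k : ℕ} → ℕ → Vec ℕ k → Vec ℕ k
shiftLetters n = mapᵥ (λ x → x + n)

-- ε_{σ,s} = 0^{s_1-1} σ(1) 0^{s_2-1} σ(2) ⋯ 0^{s_n-1} σ(n)
zeros : ℕ → List ℕ
zeros zero    = []
zeros (suc k) = 0 ∷ zeros k

eps : {k : ℕ} → Vec ℕ k → Vec ℕ k → List ℕ
eps []ᵥ       []ᵥ       = []
eps (x ∷ᵥ xs) (s ∷ᵥ ss) = zeros (s ∸ 1) ++ (x ∷ eps xs ss)

-- The algebra FQSym^(ℕ*) over a commutative ring R, realised as formal
-- finite linear combinations of colored words; a colored word is a list of
-- colored letters (letter , color).  The basis element F_{σ,I} is the colored
-- word (σ(1),i_1)⋯(σ(n),i_n).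

ColWord : Set
ColWord = List (ℕ × ℕ)

module FQSymN {c ℓ} (R : CommutativeRing c ℓ) where
  open CommutativeRing R renaming (_+_ to _+ᴿ_; _*_ to _*ᴿ_)

  Elem : Set c
  Elem = List (Carrier × ColWord)

  colWordDec = LP.≡-dec (×P.≡-dec _≟_ _≟_)

  coeff : Elem → ColWord → Carrier
  coeff []             w = 0#
  coeff ((a , u) ∷ xs) w with colWordDec u w
  ... | yes _ = a +ᴿ coeff xs w
  ... | no  _ = coeff xs w

  _≋_ : Elem → Elem → Set ℓ
  x ≋ y = ∀ w → coeff x w ≈ coeff y w

  fromℕ : ℕ → Carrier
  fromℕ zero    = 0#
  fromℕ (suc n) = 1# +ᴿ fromℕ n

  IsCharZero : Set ℓ
  IsCharZero = ∀ n → ¬ (fromℕ (suc n) ≈ 0#)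

  scale : Carrier → Elem → Elem
  scale a = map (λ { (b , w) → (a *ᴿ b , w) })

  Σ-list : {A : Set} → List A → (A → Elem) → Elem
  Σ-list xs f = concatMap f xs

  shiftCol : ℕ → ColWord → ColWord
  shiftCol n = map (λ { (l , col) → (l + n , col) })

  _⋆_ : Elem → Elem → Elem
  x ⋆ y = concatMap (λ { (a , u) → concatMap (λ { (b , v) →
            map (λ w → (a *ᴿ b , w)) (shuffles u (shiftCol (length u) v)) }) y }) x

  colWord : {n : ℕ} → Vec (Fin n) n → Vec ℕ n → ColWord
  colWord σ I = toList (zipWith _,_ (letters σ) I)

  F : {n : ℕ} → Vec (Fin n) n → Vec ℕ n → Elem
  F σ I = (1# , colWord σ I) ∷ []

-- Expanding F_{σ,I} = ∑_J c_IJ Z_{σ,J}, the number c_IJ counts the readings of the word ε_{σ,J}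
-- as the colored word (σ , I): each nonzero letter closes a block formed by itself and i ∸ 1 of the
-- zeros read before it. Readings are compatible with shuffles: the readings of e by the shuffles of
-- two colored words are the products of readings of the two subwords of e cut out by an unshuffle,
-- the pending zeros being shared binomially between the sides. Hence the coefficients of F ⋆ F in
-- the Z-basis are ∑_{A,B} c_{I₁A} c_{I₂B} ⟨ε_{σ,J} ∣ ε_A ⧢ ε_B⟩, which is also the image of the
-- coefficients of Z ⋆ Z under the transform by c ⊗ c. That transform is injective because (c_IJ)
-- is unitriangular, so the two expansions agree.
module Submission where

open import Algebra.Bundles using (CommutativeSemiring; CommutativeRing)

module ListSum {c ℓ} (S : CommutativeSemiring c ℓ) where
  open import Level using (Level)
  open import Data.List using (List; []; _∷_; _++_; map; concatMap)
  open import Data.List.Relation.Unary.All using (All; []; _∷_)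
  open CommutativeSemiring S
  open import Relation.Binary.Reasoning.Setoid setoid
  open import Algebra.Properties.CommutativeSemigroup +-commutativeSemigroup using (x∙yz≈y∙xz)

  private variable
    a b : Level
    A B : Set a

  ∑ : List A → (A → Carrier) → Carrier
  ∑ []       f = 0#
  ∑ (x ∷ xs) f = f x + ∑ xs f

  ∑-cong : (xs : List A) {f g : A → Carrier} → (∀ x → f x ≈ g x) → ∑ xs f ≈ ∑ xs g
  ∑-cong []       eq = refl
  ∑-cong (x ∷ xs) eq = +-cong (eq x) (∑-cong xs eq)

  ∑-cong-All : {p : Level} {P : A → Set p} (xs : List A) {f g : A → Carrier} →
               All P xs → (∀ x → P x → f x ≈ g x) → ∑ xs f ≈ ∑ xs g
  ∑-cong-All []       []       eq = refl
  ∑-cong-All (x ∷ xs) (p ∷ ps) eq = +-cong (eq x p) (∑-cong-All xs ps eq)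

  ∑-zero : (xs : List A) {f : A → Carrier} → (∀ x → f x ≈ 0#) → ∑ xs f ≈ 0#
  ∑-zero []       eq = refl
  ∑-zero (x ∷ xs) eq = trans (+-cong (eq x) (∑-zero xs eq)) (+-identityˡ 0#)

  ∑-++ : (xs ys : List A) (f : A → Carrier) → ∑ (xs ++ ys) f ≈ ∑ xs f + ∑ ys f
  ∑-++ []       ys f = sym (+-identityˡ _)
  ∑-++ (x ∷ xs) ys f = trans (+-cong refl (∑-++ xs ys f)) (sym (+-assoc _ _ _))

  ∑-map : (h : A → B) (xs : List A) (f : B → Carrier) → ∑ (map h xs) f ≈ ∑ xs (λ x → f (h x))
  ∑-map h []       f = refl
  ∑-map h (x ∷ xs) f = +-cong refl (∑-map h xs f)

  ∑-concatMap : (h : A → List B) (xs : List A) (f : B → Carrier) →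
                ∑ (concatMap h xs) f ≈ ∑ xs (λ x → ∑ (h x) f)
  ∑-concatMap h []       f = refl
  ∑-concatMap h (x ∷ xs) f = trans (∑-++ (h x) (concatMap h xs) f) (+-cong refl (∑-concatMap h xs f))

  *-distribˡ-∑ : (xs : List A) (a : Carrier) (f : A → Carrier) → a * ∑ xs f ≈ ∑ xs (λ x → a * f x)
  *-distribˡ-∑ []       a f = zeroʳ a
  *-distribˡ-∑ (x ∷ xs) a f = trans (distribˡ a _ _) (+-cong refl (*-distribˡ-∑ xs a f))

  *-distribʳ-∑ : (xs : List A) (a : Carrier) (f : A → Carrier) → ∑ xs f * a ≈ ∑ xs (λ x → f x * a)
  *-distribʳ-∑ xs a f =
    trans (*-comm _ a) (trans (*-distribˡ-∑ xs a f) (∑-cong xs (λ x → *-comm a (f x))))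

  ∑-+ : (xs : List A) (f g : A → Carrier) → ∑ xs (λ x → f x + g x) ≈ ∑ xs f + ∑ xs g
  ∑-+ []       f g = sym (+-identityˡ 0#)
  ∑-+ (x ∷ xs) f g = begin
    (f x + g x) + ∑ xs (λ x → f x + g x) ≈⟨ +-cong refl (∑-+ xs f g) ⟩
    (f x + g x) + (∑ xs f + ∑ xs g)       ≈⟨ +-assoc _ _ _ ⟩
    f x + (g x + (∑ xs f + ∑ xs g))       ≈⟨ +-cong refl (x∙yz≈y∙xz _ _ _) ⟩
    f x + (∑ xs f + (g x + ∑ xs g))       ≈⟨ +-assoc _ _ _ ⟨
    (f x + ∑ xs f) + (g x + ∑ xs g)       ∎

  ∑-comm : (xs : List A) (ys : List B) (f : A → B → Carrier) →
           ∑ xs (λ x → ∑ ys (f x)) ≈ ∑ ys (λ y → ∑ xs (λ x → f x y))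
  ∑-comm []       ys f = sym (∑-zero ys (λ _ → refl))
  ∑-comm (x ∷ xs) ys f =
    trans (+-cong refl (∑-comm xs ys f)) (sym (∑-+ ys (f x) (λ y → ∑ xs (λ x' → f x' y))))

module Indicator where
  open import Data.Nat using (ℕ; suc; _*_; _≟_)
  open import Data.Nat.Properties using (suc-injective; +-identityʳ; +-*-commutativeSemiring)
  open import Data.List using (List; []; _∷_)
  import Data.List.Properties as List
  open import Data.Vec using (Vec; []; _∷_)
  import Data.Vec.Properties as Vec
  open import Data.Empty using (⊥-elim)
  open import Function using (_∘_)
  open import Relation.Nullary using (Dec; does; yes; no; ¬_)
  open import Data.Bool using (true; false; _∧_; if_then_else_)
  open import Relation.Binary.PropositionalEquality
  open import Defs using (occ)
  open ListSum +-*-commutativeSemiring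

  𝟙 : {P : Set} → Dec P → ℕ
  𝟙 d = if does d then 1 else 0

  𝟙-yes : {P : Set} (d : Dec P) → P → 𝟙 d ≡ 1
  𝟙-yes (yes _) _ = refl
  𝟙-yes (no ¬p) p = ⊥-elim (¬p p)

  𝟙-no : {P : Set} (d : Dec P) → ¬ P → 𝟙 d ≡ 0
  𝟙-no (yes p) ¬p = ⊥-elim (¬p p)
  𝟙-no (no _)  _  = refl

  𝟙≢0⇒ : {P : Set} (d : Dec P) → ¬ 𝟙 d ≡ 0 → P
  𝟙≢0⇒ (yes p) _   = p
  𝟙≢0⇒ (no _)  1≢0 = ⊥-elim (1≢0 refl)

  δ : ℕ → ℕ → ℕ
  δ x y = 𝟙 (x ≟ y)

  δ⋆ : List ℕ → List ℕ → ℕ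
  δ⋆ u v = 𝟙 (List.≡-dec _≟_ u v)

  δⱽ : ∀ {k} → Vec ℕ k → Vec ℕ k → ℕ
  δⱽ u v = 𝟙 (Vec.≡-dec _≟_ u v)

  δ-refl : ∀ x → δ x x ≡ 1
  δ-refl x = 𝟙-yes (x ≟ x) refl

  δ-sym : ∀ x y → δ x y ≡ δ y x
  δ-sym x y with x ≟ y
  ... | yes refl = refl
  ... | no x≢y   = trans (𝟙-no (x ≟ y) x≢y) (sym (𝟙-no (y ≟ x) (x≢y ∘ sym)))

  δ-suc : ∀ x y → δ (suc x) (suc y) ≡ δ x y
  δ-suc x y with x ≟ y
  ... | yes refl = refl
  ... | no x≢y   = trans (𝟙-no (suc x ≟ suc y) (x≢y ∘ suc-injective)) (sym (𝟙-no (x ≟ y) x≢y))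

  𝟙-∧ : ∀ a b → (if a ∧ b then 1 else 0) ≡ (if a then 1 else 0) * (if b then 1 else 0)
  𝟙-∧ true  b = sym (+-identityʳ _)
  𝟙-∧ false b = refl

  δ⋆-∷ : ∀ x y u v → δ⋆ (x ∷ u) (y ∷ v) ≡ δ x y * δ⋆ u v
  δ⋆-∷ x y u v = 𝟙-∧ (does (x ≟ y)) (does (List.≡-dec _≟_ u v))

  δⱽ-∷ : ∀ {k} x y (u v : Vec ℕ k) → δⱽ (x ∷ u) (y ∷ v) ≡ δ x y * δⱽ u v
  δⱽ-∷ x y u v = 𝟙-∧ (does (x ≟ y)) (does (Vec.≡-dec _≟_ u v))

  occ≡∑δ⋆ : ∀ w P → occ w P ≡ ∑ P (δ⋆ w)
  occ≡∑δ⋆ w []      = refl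
  occ≡∑δ⋆ w (v ∷ P) with List.≡-dec _≟_ w v
  ... | yes _ = cong suc (occ≡∑δ⋆ w P)
  ... | no  _ = occ≡∑δ⋆ w P

module Binomial where
  open import Data.Nat
  open import Data.Nat.Properties
  open import Data.Nat.Combinatorics
  open import Data.Nat.DivMod using (m*[n/m]≡n)
  open import Data.Nat.Tactic.RingSolver using (solve-∀)
  open import Relation.Binary.PropositionalEquality
  open import Relation.Nullary using (yes; no)
  open ≡-Reasoning

  nCk*[k!*[n∸k]!]≡n! : ∀ {n k} → k ≤ n → (n C k) * (k ! * (n ∸ k) !) ≡ n !
  nCk*[k!*[n∸k]!]≡n! {n} {k} k≤n = begin
    (n C k) * (k ! * (n ∸ k) !)                        ≡⟨ cong (_* d) (nCk≡n!/k![n-k]! k≤n) ⟩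
    (n ! / d) {{k !* (n ∸ k) !≢0}} * d                 ≡⟨ *-comm _ d ⟩
    d * (n ! / d) {{k !* (n ∸ k) !≢0}}                 ≡⟨ m*[n/m]≡n {{k !* (n ∸ k) !≢0}} (k![n∸k]!∣n! k≤n) ⟩
    n !                                                ∎
    where d = k ! * (n ∸ k) !

  nC[j+k]*[j+k]Cj≡nCj*[n∸j]Ck : ∀ n j k → (n C (j + k)) * ((j + k) C j) ≡ (n C j) * ((n ∸ j) C k)
  nC[j+k]*[j+k]Cj≡nCj*[n∸j]Ck n j k with j + k ≤? n
  ... | yes j+k≤n = *-cancelʳ-≡ _ _ (j ! * k ! * r !) {{d≢0}} (begin
      (n C (j + k)) * ((j + k) C j) * (j ! * k ! * r !)          ≡⟨ regroupˡ (n C (j + k)) ((j + k) C j) (j !) (k !) (r !) ⟩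
      (n C (j + k)) * (((j + k) C j) * (j ! * k !)) * r !        ≡⟨ cong (λ t → (n C (j + k)) * (((j + k) C j) * (j ! * t !)) * r !) (sym (m+n∸m≡n j k)) ⟩
      (n C (j + k)) * (((j + k) C j) * (j ! * (j + k ∸ j) !)) * r !
                                                                 ≡⟨ cong (λ t → (n C (j + k)) * t * r !) (nCk*[k!*[n∸k]!]≡n! (m≤m+n j k)) ⟩
      (n C (j + k)) * (j + k) ! * r !                            ≡⟨ *-assoc (n C (j + k)) _ _ ⟩
      (n C (j + k)) * ((j + k) ! * r !)                          ≡⟨ nCk*[k!*[n∸k]!]≡n! j+k≤n ⟩
      n !                                                        ≡⟨ nCk*[k!*[n∸k]!]≡n! j≤n ⟨
      (n C j) * (j ! * (n ∸ j) !)                                ≡⟨ cong (λ t → (n C j) * (j ! * t)) (nCk*[k!*[n∸k]!]≡n! k≤n∸j) ⟨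
      (n C j) * (j ! * (((n ∸ j) C k) * (k ! * (n ∸ j ∸ k) !)))  ≡⟨ cong (λ t → (n C j) * (j ! * (((n ∸ j) C k) * (k ! * t !)))) (∸-+-assoc n j k) ⟩
      (n C j) * (j ! * (((n ∸ j) C k) * (k ! * r !)))            ≡⟨ regroupʳ (n C j) (j !) ((n ∸ j) C k) (k !) (r !) ⟩
      (n C j) * ((n ∸ j) C k) * (j ! * k ! * r !)                ∎)
    where
    r = n ∸ (j + k)
    j≤n = ≤-trans (m≤m+n j k) j+k≤n
    k≤n∸j = subst (_≤ n ∸ j) (m+n∸m≡n j k) (∸-monoˡ-≤ j j+k≤n)
    d≢0 = >-nonZero (*-mono-≤ (*-mono-≤ (1≤n! j) (1≤n! k)) (1≤n! r))
    regroupˡ : ∀ a b x y z → a * b * (x * y * z) ≡ a * (b * (x * y)) * z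
    regroupˡ = solve-∀
    regroupʳ : ∀ a x b y z → a * (x * (b * (y * z))) ≡ a * b * (x * y * z)
    regroupʳ = solve-∀
  ... | no j+k≰n with j ≤? n
  ...   | yes j≤n = begin
      (n C (j + k)) * ((j + k) C j) ≡⟨ cong (_* ((j + k) C j)) (k>n⇒nCk≡0 (≰⇒> j+k≰n)) ⟩
      0                             ≡⟨ *-zeroʳ (n C j) ⟨
      (n C j) * 0                   ≡⟨ cong ((n C j) *_) (k>n⇒nCk≡0 k>n∸j) ⟨
      (n C j) * ((n ∸ j) C k)       ∎
    where
    k>n∸j : k > n ∸ j
    k>n∸j = ≰⇒> λ k≤n∸j → j+k≰n (subst (j + k ≤_) (m+[n∸m]≡n j≤n) (+-monoʳ-≤ j k≤n∸j))
  ...   | no j≰n =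
    trans (cong (_* ((j + k) C j)) (k>n⇒nCk≡0 (≰⇒> j+k≰n))) (sym (cong (_* ((n ∸ j) C k)) (k>n⇒nCk≡0 (≰⇒> j≰n))))

  ∑≤ : ℕ → (ℕ → ℕ) → ℕ
  ∑≤ zero    h = h 0
  ∑≤ (suc f) h = h 0 + ∑≤ f (λ k → h (suc k))

  ∑≤-cong : ∀ f {h h′} → (∀ k → k ≤ f → h k ≡ h′ k) → ∑≤ f h ≡ ∑≤ f h′
  ∑≤-cong zero    eq = eq 0 z≤n
  ∑≤-cong (suc f) eq = cong₂ _+_ (eq 0 z≤n) (∑≤-cong f (λ k k≤f → eq (suc k) (s≤s k≤f)))

  ∑≤-zero : ∀ f {h} → (∀ k → k ≤ f → h k ≡ 0) → ∑≤ f h ≡ 0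
  ∑≤-zero zero    eq = eq 0 z≤n
  ∑≤-zero (suc f) eq = cong₂ _+_ (eq 0 z≤n) (∑≤-zero f (λ k k≤f → eq (suc k) (s≤s k≤f)))

  *-distribˡ-∑≤ : ∀ f a h → a * ∑≤ f h ≡ ∑≤ f (λ k → a * h k)
  *-distribˡ-∑≤ zero    a h = refl
  *-distribˡ-∑≤ (suc f) a h = trans (*-distribˡ-+ a (h 0) _) (cong (a * h 0 +_) (*-distribˡ-∑≤ f a (λ k → h (suc k))))

  ∑≤-+ : ∀ f h g → ∑≤ f (λ k → h k + g k) ≡ ∑≤ f h + ∑≤ f g
  ∑≤-+ zero    h g = refl
  ∑≤-+ (suc f) h g = trans (cong (h 0 + g 0 +_) (∑≤-+ f _ _)) (interchange (h 0) (g 0) _ _)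
    where
    interchange : ∀ a b c d → a + b + (c + d) ≡ a + c + (b + d)
    interchange = solve-∀

  ∑≤-last : ∀ f h → ∑≤ (suc f) h ≡ ∑≤ f h + h (suc f)
  ∑≤-last zero    h = refl
  ∑≤-last (suc f) h = trans (cong (h 0 +_) (∑≤-last f (λ k → h (suc k)))) (sym (+-assoc (h 0) _ _))

  ∑≤-dropˡ : ∀ j f h → j ≤ f → (∀ k → k < j → h k ≡ 0) → ∑≤ f h ≡ ∑≤ (f ∸ j) (λ k → h (j + k))
  ∑≤-dropˡ zero    f       h _         _ = refl
  ∑≤-dropˡ (suc j) (suc f) h (s≤s j≤f) z = trans (cong (_+ ∑≤ f (λ k → h (suc k))) (z 0 (s≤s z≤n)))
    (∑≤-dropˡ j f (λ k → h (suc k)) j≤f (λ k k<j → z (suc k) (s≤s k<j)))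

  ∑≤-dropʳ : ∀ e f h → e ≤ f → (∀ k → e < k → k ≤ f → h k ≡ 0) → ∑≤ f h ≡ ∑≤ e h
  ∑≤-dropʳ e zero    h z≤n _ = refl
  ∑≤-dropʳ e (suc f) h e≤f z with e ≟ suc f
  ... | yes refl = refl
  ... | no  e≢f  = begin
    ∑≤ (suc f) h           ≡⟨ ∑≤-last f h ⟩
    ∑≤ f h + h (suc f)     ≡⟨ cong (∑≤ f h +_) (z (suc f) e<f ≤-refl) ⟩
    ∑≤ f h + 0             ≡⟨ +-identityʳ _ ⟩
    ∑≤ f h                 ≡⟨ ∑≤-dropʳ e f h (s≤s⁻¹ e<f) (λ k e<k k≤f → z k e<k (m≤n⇒m≤1+n k≤f)) ⟩
    ∑≤ e h                 ∎
    where e<f = ≤∧≢⇒< e≤f e≢f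

  m*[n*o]≡0 : ∀ m {n} o → n ≡ 0 → m * (n * o) ≡ 0
  m*[n*o]≡0 m o refl = *-zeroʳ m

  -- Choosing j out of f objects and then splitting the remaining f ∸ j into two blocks
  -- is the same as first splitting all f objects into two blocks and then choosing the
  -- j objects inside the first (ˡ) or inside the second (ʳ) block.

  choose-split≡split-chooseˡ : ∀ f j (G : ℕ → ℕ → ℕ) →
    (f C j) * ∑≤ (f ∸ j) (λ k → ((f ∸ j) C k) * G k (f ∸ j ∸ k))
    ≡ ∑≤ f (λ k → (f C k) * ((k C j) * G (k ∸ j) (f ∸ k)))
  choose-split≡split-chooseˡ f j G with j ≤? f
  ... | yes j≤f = sym (begin
    ∑≤ f (λ k → (f C k) * ((k C j) * G (k ∸ j) (f ∸ k)))
      ≡⟨ ∑≤-dropˡ j f _ j≤f (λ k k<j → m*[n*o]≡0 (f C k) _ (k>n⇒nCk≡0 k<j)) ⟩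
    ∑≤ (f ∸ j) (λ k → (f C (j + k)) * (((j + k) C j) * G (j + k ∸ j) (f ∸ (j + k))))
      ≡⟨ ∑≤-cong (f ∸ j) (λ k _ → term k) ⟩
    ∑≤ (f ∸ j) (λ k → (f C j) * (((f ∸ j) C k) * G k (f ∸ j ∸ k)))
      ≡⟨ *-distribˡ-∑≤ (f ∸ j) (f C j) _ ⟨
    (f C j) * ∑≤ (f ∸ j) (λ k → ((f ∸ j) C k) * G k (f ∸ j ∸ k)) ∎)
    where
    term : ∀ k → (f C (j + k)) * (((j + k) C j) * G (j + k ∸ j) (f ∸ (j + k)))
               ≡ (f C j) * (((f ∸ j) C k) * G k (f ∸ j ∸ k))
    term k = begin
      (f C (j + k)) * (((j + k) C j) * G (j + k ∸ j) (f ∸ (j + k)))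
        ≡⟨ cong₂ (λ a b → (f C (j + k)) * (((j + k) C j) * G a b)) (m+n∸m≡n j k) (sym (∸-+-assoc f j k)) ⟩
      (f C (j + k)) * (((j + k) C j) * G k (f ∸ j ∸ k))
        ≡⟨ *-assoc (f C (j + k)) _ _ ⟨
      (f C (j + k)) * ((j + k) C j) * G k (f ∸ j ∸ k)
        ≡⟨ cong (_* G k (f ∸ j ∸ k)) (nC[j+k]*[j+k]Cj≡nCj*[n∸j]Ck f j k) ⟩
      (f C j) * ((f ∸ j) C k) * G k (f ∸ j ∸ k)
        ≡⟨ *-assoc (f C j) _ _ ⟩
      (f C j) * (((f ∸ j) C k) * G k (f ∸ j ∸ k)) ∎
  ... | no j≰f = trans (cong (_* ∑≤ (f ∸ j) (λ k → ((f ∸ j) C k) * G k (f ∸ j ∸ k))) (k>n⇒nCk≡0 (≰⇒> j≰f)))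
    (sym (∑≤-zero f (λ k k≤f → m*[n*o]≡0 (f C k) _ (k>n⇒nCk≡0 (≤-<-trans k≤f (≰⇒> j≰f))))))

  choose-split≡split-chooseʳ : ∀ f j (G : ℕ → ℕ → ℕ) →
    (f C j) * ∑≤ (f ∸ j) (λ k → ((f ∸ j) C k) * G k (f ∸ j ∸ k))
    ≡ ∑≤ f (λ k → (f C k) * (((f ∸ k) C j) * G k (f ∸ k ∸ j)))
  choose-split≡split-chooseʳ f j G with j ≤? f
  ... | yes j≤f = sym (begin
    ∑≤ f (λ k → (f C k) * (((f ∸ k) C j) * G k (f ∸ k ∸ j)))
      ≡⟨ ∑≤-dropʳ (f ∸ j) f _ (m∸n≤m f j) (λ k f∸j<k k≤f → m*[n*o]≡0 (f C k) _ (k>n⇒nCk≡0 (f∸k<j k f∸j<k k≤f))) ⟩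
    ∑≤ (f ∸ j) (λ k → (f C k) * (((f ∸ k) C j) * G k (f ∸ k ∸ j)))
      ≡⟨ ∑≤-cong (f ∸ j) (λ k _ → term k) ⟩
    ∑≤ (f ∸ j) (λ k → (f C j) * (((f ∸ j) C k) * G k (f ∸ j ∸ k)))
      ≡⟨ *-distribˡ-∑≤ (f ∸ j) (f C j) _ ⟨
    (f C j) * ∑≤ (f ∸ j) (λ k → ((f ∸ j) C k) * G k (f ∸ j ∸ k)) ∎)
    where
    f∸k<j : ∀ k → f ∸ j < k → k ≤ f → f ∸ k < j
    f∸k<j k f∸j<k k≤f = +-cancelʳ-< k (f ∸ k) j (subst (_< j + k) (sym (m∸n+n≡m k≤f)) f<j+k)
      where
      f<j+k : f < j + k
      f<j+k = subst (_< j + k) (m∸n+n≡m j≤f) (subst (f ∸ j + j <_) (+-comm k j) (+-monoˡ-< j f∸j<k))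
    ∸-comm : ∀ a b c → a ∸ b ∸ c ≡ a ∸ c ∸ b
    ∸-comm a b c = trans (∸-+-assoc a b c) (trans (cong (a ∸_) (+-comm b c)) (sym (∸-+-assoc a c b)))
    fCk*[f∸k]Cj≡fCj*[f∸j]Ck : ∀ k → (f C k) * ((f ∸ k) C j) ≡ (f C j) * ((f ∸ j) C k)
    fCk*[f∸k]Cj≡fCj*[f∸j]Ck k = begin
      (f C k) * ((f ∸ k) C j)        ≡⟨ nC[j+k]*[j+k]Cj≡nCj*[n∸j]Ck f k j ⟨
      (f C (k + j)) * ((k + j) C k)  ≡⟨ cong₂ (λ a b → (f C a) * b) (+-comm k j) (sym [j+k]Cj≡[k+j]Ck) ⟩
      (f C (j + k)) * ((j + k) C j)  ≡⟨ nC[j+k]*[j+k]Cj≡nCj*[n∸j]Ck f j k ⟩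
      (f C j) * ((f ∸ j) C k)        ∎
      where
      [j+k]Cj≡[k+j]Ck : ((j + k) C j) ≡ ((k + j) C k)
      [j+k]Cj≡[k+j]Ck = trans (nCk≡nC[n∸k] (m≤m+n j k)) (trans (cong ((j + k) C_) (m+n∸m≡n j k)) (cong (_C k) (+-comm j k)))
    term : ∀ k → (f C k) * (((f ∸ k) C j) * G k (f ∸ k ∸ j)) ≡ (f C j) * (((f ∸ j) C k) * G k (f ∸ j ∸ k))
    term k = begin
      (f C k) * (((f ∸ k) C j) * G k (f ∸ k ∸ j)) ≡⟨ *-assoc (f C k) _ _ ⟨
      (f C k) * ((f ∸ k) C j) * G k (f ∸ k ∸ j)   ≡⟨ cong₂ (λ a b → a * G k b) (fCk*[f∸k]Cj≡fCj*[f∸j]Ck k) (∸-comm f k j) ⟩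
      (f C j) * ((f ∸ j) C k) * G k (f ∸ j ∸ k)   ≡⟨ *-assoc (f C j) _ _ ⟩
      (f C j) * (((f ∸ j) C k) * G k (f ∸ j ∸ k)) ∎
  ... | no j≰f = trans (cong (_* ∑≤ (f ∸ j) (λ k → ((f ∸ j) C k) * G k (f ∸ j ∸ k))) (k>n⇒nCk≡0 (≰⇒> j≰f)))
    (sym (∑≤-zero f (λ k k≤f → m*[n*o]≡0 (f C k) _ (k>n⇒nCk≡0 (≤-<-trans (m∸n≤m f k) (≰⇒> j≰f))))))

module Shuffle where
  open import Data.Nat using (ℕ; _+_; _*_)
  open import Data.Nat.Properties using (+-identityʳ; *-zeroʳ; *-assoc; *-commutativeSemigroup; +-*-commutativeSemiring)
  open import Data.Product using (_×_; _,_; map₁; map₂)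
  open import Data.List using (List; []; _∷_; _++_; map)
  import Data.List.Properties as List
  open import Function using (_∘_)
  open import Relation.Binary.PropositionalEquality
  open import Defs using (shuffles)
  open Indicator
  open ListSum +-*-commutativeSemiring
  open ≡-Reasoning
  open import Algebra.Properties.CommutativeSemigroup *-commutativeSemigroup using (x∙yz≈y∙xz)

  private variable
    A B : Set

  shuffles-[]ʳ : (xs : List A) → shuffles xs [] ≡ xs ∷ []
  shuffles-[]ʳ []      = refl
  shuffles-[]ʳ (_ ∷ _) = refl

  map-shuffles : (f : A → B) (xs ys : List A) →
                 map (map f) (shuffles xs ys) ≡ shuffles (map f xs) (map f ys)
  map-shuffles f []       ys       = refl
  map-shuffles f (x ∷ xs) []       = refl
  map-shuffles f (x ∷ xs) (y ∷ ys) = begin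
    map (map f) (map (x ∷_) S₁ ++ map (y ∷_) S₂)                   ≡⟨ List.map-++ (map f) (map (x ∷_) S₁) _ ⟩
    map (map f) (map (x ∷_) S₁) ++ map (map f) (map (y ∷_) S₂)     ≡⟨ cong₂ _++_ (List.map-∘ S₁) (List.map-∘ S₂) ⟨
    map (λ l → f x ∷ map f l) S₁ ++ map (λ l → f y ∷ map f l) S₂   ≡⟨ cong₂ _++_ (List.map-∘ S₁) (List.map-∘ S₂) ⟩
    map (f x ∷_) (map (map f) S₁) ++ map (f y ∷_) (map (map f) S₂) ≡⟨ cong₂ (λ T₁ T₂ → map (f x ∷_) T₁ ++ map (f y ∷_) T₂)
                                                                        (map-shuffles f xs (y ∷ ys)) (map-shuffles f (x ∷ xs) ys) ⟩
    shuffles (map f (x ∷ xs)) (map f (y ∷ ys))                     ∎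
    where
    S₁ = shuffles xs (y ∷ ys)
    S₂ = shuffles (x ∷ xs) ys

  ∑-shuffles-∷-∷ : (F : List A → ℕ) (x : A) (xs : List A) (y : A) (ys : List A) →
    ∑ (shuffles (x ∷ xs) (y ∷ ys)) F ≡ ∑ (shuffles xs (y ∷ ys)) (F ∘ (x ∷_)) + ∑ (shuffles (x ∷ xs) ys) (F ∘ (y ∷_))
  ∑-shuffles-∷-∷ F x xs y ys = begin
    ∑ (map (x ∷_) S₁ ++ map (y ∷_) S₂) F               ≡⟨ ∑-++ (map (x ∷_) S₁) _ F ⟩
    ∑ (map (x ∷_) S₁) F + ∑ (map (y ∷_) S₂) F          ≡⟨ cong₂ _+_ (∑-map (x ∷_) S₁ F) (∑-map (y ∷_) S₂ F) ⟩
    ∑ S₁ (F ∘ (x ∷_)) + ∑ S₂ (F ∘ (y ∷_))              ∎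
    where
    S₁ = shuffles xs (y ∷ ys)
    S₂ = shuffles (x ∷ xs) ys

  onHead : List A → (A → List A → ℕ) → ℕ
  onHead []       h = 0
  onHead (x ∷ xs) h = h x xs

  ∑-shuffles-∷ : (F : List A → ℕ) → F [] ≡ 0 → ∀ xs ys →
    ∑ (shuffles xs ys) F ≡ onHead xs (λ x xs′ → ∑ (shuffles xs′ ys) (F ∘ (x ∷_)))
                           + onHead ys (λ y ys′ → ∑ (shuffles xs ys′) (F ∘ (y ∷_)))
  ∑-shuffles-∷ F F[]≡0 []       []       = cong (_+ 0) F[]≡0
  ∑-shuffles-∷ F F[]≡0 []       (y ∷ ys) = refl
  ∑-shuffles-∷ F F[]≡0 (x ∷ xs) []       =
    cong (_+ 0) (sym (trans (cong (λ S → ∑ S (F ∘ (x ∷_))) (shuffles-[]ʳ xs)) (+-identityʳ _)))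
  ∑-shuffles-∷ F F[]≡0 (x ∷ xs) (y ∷ ys) = ∑-shuffles-∷-∷ F x xs y ys

  unshuffles : List A → List (List A × List A)
  unshuffles []      = ([] , []) ∷ []
  unshuffles (x ∷ w) = map (map₁ (x ∷_)) (unshuffles w) ++ map (map₂ (x ∷_)) (unshuffles w)

  ∑-unshuffles-∷ : (x : A) (w : List A) (F : List A × List A → ℕ) →
    ∑ (unshuffles (x ∷ w)) F ≡ ∑ (unshuffles w) (F ∘ map₁ (x ∷_)) + ∑ (unshuffles w) (F ∘ map₂ (x ∷_))
  ∑-unshuffles-∷ x w F = trans (∑-++ (map (map₁ (x ∷_)) (unshuffles w)) _ F)
    (cong₂ _+_ (∑-map (map₁ (x ∷_)) (unshuffles w) F) (∑-map (map₂ (x ∷_)) (unshuffles w) F))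

  -- ⟨ w ∣ a ⧢ b ⟩ counts the ways of cutting w into a subword a and the complementary subword b.
  ∑-shuffles-δ⋆ : ∀ w a b → ∑ (shuffles a b) (δ⋆ w) ≡ ∑ (unshuffles w) (λ (p , q) → δ⋆ p a * δ⋆ q b)
  ∑-shuffles-δ⋆ []      []      b       = cong (_+ 0) (sym (+-identityʳ (δ⋆ [] b)))
  ∑-shuffles-δ⋆ []      (x ∷ a) []      = refl
  ∑-shuffles-δ⋆ []      (x ∷ a) (y ∷ b) = trans (∑-shuffles-∷-∷ (δ⋆ []) x a y b)
    (cong₂ _+_ (∑-zero (shuffles a (y ∷ b)) (λ _ → refl)) (∑-zero (shuffles (x ∷ a) b) (λ _ → refl)))
  ∑-shuffles-δ⋆ (z ∷ w) a b = begin
    ∑ (shuffles a b) (δ⋆ (z ∷ w))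
      ≡⟨ ∑-shuffles-∷ (δ⋆ (z ∷ w)) refl a b ⟩
    onHead a (λ x a′ → ∑ (shuffles a′ b) (δ⋆ (z ∷ w) ∘ (x ∷_))) + onHead b (λ y b′ → ∑ (shuffles a b′) (δ⋆ (z ∷ w) ∘ (y ∷_)))
      ≡⟨ cong₂ _+_ (fromLeft a) (fromRight b) ⟩
    ∑ (unshuffles w) (λ (p , q) → δ⋆ (z ∷ p) a * δ⋆ q b) + ∑ (unshuffles w) (λ (p , q) → δ⋆ p a * δ⋆ (z ∷ q) b)
      ≡⟨ ∑-unshuffles-∷ z w (λ (p , q) → δ⋆ p a * δ⋆ q b) ⟨
    ∑ (unshuffles (z ∷ w)) (λ (p , q) → δ⋆ p a * δ⋆ q b) ∎
    where
    fromLeft : ∀ a → onHead a (λ x a′ → ∑ (shuffles a′ b) (δ⋆ (z ∷ w) ∘ (x ∷_)))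
                     ≡ ∑ (unshuffles w) (λ (p , q) → δ⋆ (z ∷ p) a * δ⋆ q b)
    fromLeft []      = sym (∑-zero (unshuffles w) (λ _ → refl))
    fromLeft (x ∷ a) = begin
      ∑ (shuffles a b) (δ⋆ (z ∷ w) ∘ (x ∷_))                  ≡⟨ ∑-cong (shuffles a b) (λ v → δ⋆-∷ z x w v) ⟩
      ∑ (shuffles a b) (λ v → δ z x * δ⋆ w v)                 ≡⟨ *-distribˡ-∑ (shuffles a b) (δ z x) (δ⋆ w) ⟨
      δ z x * ∑ (shuffles a b) (δ⋆ w)                         ≡⟨ cong (δ z x *_) (∑-shuffles-δ⋆ w a b) ⟩
      δ z x * ∑ (unshuffles w) (λ (p , q) → δ⋆ p a * δ⋆ q b)  ≡⟨ *-distribˡ-∑ (unshuffles w) (δ z x) _ ⟩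
      ∑ (unshuffles w) (λ (p , q) → δ z x * (δ⋆ p a * δ⋆ q b))
        ≡⟨ ∑-cong (unshuffles w) (λ (p , q) → trans (cong (_* δ⋆ q b) (δ⋆-∷ z x p a)) (*-assoc (δ z x) _ _)) ⟨
      ∑ (unshuffles w) (λ (p , q) → δ⋆ (z ∷ p) (x ∷ a) * δ⋆ q b) ∎
    fromRight : ∀ b → onHead b (λ y b′ → ∑ (shuffles a b′) (δ⋆ (z ∷ w) ∘ (y ∷_)))
                      ≡ ∑ (unshuffles w) (λ (p , q) → δ⋆ p a * δ⋆ (z ∷ q) b)
    fromRight []      = sym (∑-zero (unshuffles w) (λ (p , q) → *-zeroʳ (δ⋆ p a)))
    fromRight (y ∷ b) = begin
      ∑ (shuffles a b) (δ⋆ (z ∷ w) ∘ (y ∷_))                  ≡⟨ ∑-cong (shuffles a b) (λ v → δ⋆-∷ z y w v) ⟩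
      ∑ (shuffles a b) (λ v → δ z y * δ⋆ w v)                 ≡⟨ *-distribˡ-∑ (shuffles a b) (δ z y) (δ⋆ w) ⟨
      δ z y * ∑ (shuffles a b) (δ⋆ w)                         ≡⟨ cong (δ z y *_) (∑-shuffles-δ⋆ w a b) ⟩
      δ z y * ∑ (unshuffles w) (λ (p , q) → δ⋆ p a * δ⋆ q b)  ≡⟨ *-distribˡ-∑ (unshuffles w) (δ z y) _ ⟩
      ∑ (unshuffles w) (λ (p , q) → δ z y * (δ⋆ p a * δ⋆ q b))
        ≡⟨ ∑-cong (unshuffles w) (λ (p , q) → trans (cong (δ⋆ p a *_) (δ⋆-∷ z y q b)) (x∙yz≈y∙xz (δ⋆ p a) (δ z y) (δ⋆ q b))) ⟨
      ∑ (unshuffles w) (λ (p , q) → δ⋆ p a * δ⋆ (z ∷ q) (y ∷ b)) ∎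

module Readings where
  open import Data.Nat
  open import Data.Nat.Properties
  open import Data.Nat.Combinatorics using (_C_; k>n⇒nCk≡0; nCk+nC[k+1]≡[n+1]C[k+1])
  open import Data.Bool using (Bool; true; false)
  open import Data.Product using (_×_; _,_; proj₂)
  open import Data.List using (List; []; _∷_; map)
  import Data.List.Properties as List
  open import Relation.Binary.PropositionalEquality
  open import Defs using (ColWord; shuffles)
  open Indicator
  open Binomial
  open Shuffle
  open ListSum +-*-commutativeSemiring
  open import Algebra.Properties.CommutativeSemigroup *-commutativeSemigroup using (x∙yz≈y∙xz)
  open import Algebra.Properties.CommutativeSemigroup +-commutativeSemigroup using () renaming (x∙yz≈y∙xz to +-x∙yz≈y∙xz)
  open ≡-Reasoning

  δ₀ : ℕ → ℕ
  δ₀ zero    = 1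
  δ₀ (suc _) = 0

  -- readings e u f counts the ways of reading the word e over {0,1,2,…} as the colored word
  -- u while f zeros of e are pending: a nonzero letter of e must be the letter a of the next
  -- colored letter (a , i) of u, and it closes a block made of itself and i ∸ 1 pending zeros.
  -- For ε_{σ,J} and the colored word of (σ , I) these are the set partitions counted by c_IJ.
  readings : List ℕ → ColWord → ℕ → ℕ
  readings []          []            f = δ₀ f
  readings []          (_ ∷ _)       f = 0
  readings (zero ∷ e)  u             f = readings e u (suc f)
  readings (suc x ∷ e) []            f = 0
  readings (suc x ∷ e) ((a , i) ∷ u) f = δ (suc x) a * ((f C (i ∸ 1)) * readings e u (f ∸ (i ∸ 1)))

  -- Colored words whose letters are tagged as coming from the left (true) or right (false)
  -- factor of a shuffle; readings₂ keeps separate counts of the zeros pending for each side.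
  TaggedWord : Set
  TaggedWord = List (Bool × (ℕ × ℕ))

  untag : TaggedWord → ColWord
  untag = map proj₂

  readings₂ : List ℕ → TaggedWord → ℕ → ℕ → ℕ
  readings₂ []          []                      f g = δ₀ f * δ₀ g
  readings₂ []          (_ ∷ _)                 f g = 0
  readings₂ (zero ∷ e)  c                       f g = readings₂ e c (suc f) g + readings₂ e c f (suc g)
  readings₂ (suc x ∷ e) []                      f g = 0
  readings₂ (suc x ∷ e) ((true  , (a , i)) ∷ c) f g = δ (suc x) a * ((f C (i ∸ 1)) * readings₂ e c (f ∸ (i ∸ 1)) g)
  readings₂ (suc x ∷ e) ((false , (a , i)) ∷ c) f g = δ (suc x) a * ((g C (i ∸ 1)) * readings₂ e c f (g ∸ (i ∸ 1)))

  readings-untag : ∀ e c f → readings e (untag c) f ≡ ∑≤ f (λ k → (f C k) * readings₂ e c k (f ∸ k))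
  readings-untag [] [] zero = refl
  readings-untag [] [] (suc f) = sym (∑≤-zero f (λ k _ → m*[n*o]≡0 (suc f C suc k) (δ₀ (f ∸ k)) refl))
  readings-untag [] (_ ∷ c) f = sym (∑≤-zero f (λ k _ → *-zeroʳ (f C k)))
  readings-untag (suc x ∷ e) [] f = sym (∑≤-zero f (λ k _ → *-zeroʳ (f C k)))
  readings-untag (zero ∷ e) c f = begin
    readings e (untag c) (suc f)
      ≡⟨ readings-untag e c (suc f) ⟩
    H 0 + ∑≤ f (λ k → (suc f C suc k) * R (suc k) (f ∸ k))
      ≡⟨ cong (H 0 +_) (∑≤-cong f (λ k _ → trans (cong (_* R (suc k) (f ∸ k)) (sym (nCk+nC[k+1]≡[n+1]C[k+1] f k)))
                                                 (*-distribʳ-+ (R (suc k) (f ∸ k)) (f C k) (f C suc k)))) ⟩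
    H 0 + ∑≤ f (λ k → A k + B k)
      ≡⟨ cong (H 0 +_) (∑≤-+ f A B) ⟩
    H 0 + (∑≤ f A + ∑≤ f B)
      ≡⟨ +-x∙yz≈y∙xz (H 0) (∑≤ f A) (∑≤ f B) ⟩
    ∑≤ f A + (H 0 + ∑≤ f B)
      ≡⟨ cong (∑≤ f A +_) (sym shiftedB) ⟩
    ∑≤ f A + ∑≤ f D
      ≡⟨ ∑≤-+ f A D ⟨
    ∑≤ f (λ k → A k + D k)
      ≡⟨ ∑≤-cong f (λ k _ → sym (*-distribˡ-+ (f C k) _ _)) ⟩
    ∑≤ f (λ k → (f C k) * (R (suc k) (f ∸ k) + R k (suc (f ∸ k)))) ∎
    where
    R = readings₂ e c
    H A B D D′ : ℕ → ℕ
    H k = (suc f C k) * R k (suc f ∸ k)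
    A k = (f C k) * R (suc k) (f ∸ k)
    B k = (f C suc k) * R (suc k) (f ∸ k)
    D k = (f C k) * R k (suc (f ∸ k))
    D′ k = (f C k) * R k (suc f ∸ k)
    shiftedB : ∑≤ f D ≡ H 0 + ∑≤ f B
    shiftedB = begin
      ∑≤ f D                 ≡⟨ ∑≤-cong f (λ k k≤f → cong (λ t → (f C k) * R k t) (sym (+-∸-assoc 1 k≤f))) ⟩
      ∑≤ f D′                ≡⟨ +-identityʳ _ ⟨
      ∑≤ f D′ + 0            ≡⟨ cong (∑≤ f D′ +_) (cong (_* R (suc f) (suc f ∸ suc f)) (k>n⇒nCk≡0 (n<1+n f))) ⟨
      ∑≤ f D′ + D′ (suc f)   ≡⟨ ∑≤-last f D′ ⟨
      H 0 + ∑≤ f B           ∎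
  readings-untag (suc x ∷ e) ((true , (a , i)) ∷ c) f = begin
    δ (suc x) a * ((f C j) * readings e (untag c) (f ∸ j))
      ≡⟨ cong (λ t → δ (suc x) a * ((f C j) * t)) (readings-untag e c (f ∸ j)) ⟩
    δ (suc x) a * ((f C j) * ∑≤ (f ∸ j) (λ k → ((f ∸ j) C k) * readings₂ e c k (f ∸ j ∸ k)))
      ≡⟨ cong (δ (suc x) a *_) (choose-split≡split-chooseˡ f j (readings₂ e c)) ⟩
    δ (suc x) a * ∑≤ f (λ k → (f C k) * ((k C j) * readings₂ e c (k ∸ j) (f ∸ k)))
      ≡⟨ *-distribˡ-∑≤ f (δ (suc x) a) _ ⟩
    ∑≤ f (λ k → δ (suc x) a * ((f C k) * ((k C j) * readings₂ e c (k ∸ j) (f ∸ k))))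
      ≡⟨ ∑≤-cong f (λ k _ → x∙yz≈y∙xz (δ (suc x) a) (f C k) _) ⟩
    ∑≤ f (λ k → (f C k) * (δ (suc x) a * ((k C j) * readings₂ e c (k ∸ j) (f ∸ k)))) ∎
    where j = i ∸ 1
  readings-untag (suc x ∷ e) ((false , (a , i)) ∷ c) f = begin
    δ (suc x) a * ((f C j) * readings e (untag c) (f ∸ j))
      ≡⟨ cong (λ t → δ (suc x) a * ((f C j) * t)) (readings-untag e c (f ∸ j)) ⟩
    δ (suc x) a * ((f C j) * ∑≤ (f ∸ j) (λ k → ((f ∸ j) C k) * readings₂ e c k (f ∸ j ∸ k)))
      ≡⟨ cong (δ (suc x) a *_) (choose-split≡split-chooseʳ f j (readings₂ e c)) ⟩
    δ (suc x) a * ∑≤ f (λ k → (f C k) * (((f ∸ k) C j) * readings₂ e c k (f ∸ k ∸ j)))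
      ≡⟨ *-distribˡ-∑≤ f (δ (suc x) a) _ ⟩
    ∑≤ f (λ k → δ (suc x) a * ((f C k) * (((f ∸ k) C j) * readings₂ e c k (f ∸ k ∸ j))))
      ≡⟨ ∑≤-cong f (λ k _ → x∙yz≈y∙xz (δ (suc x) a) (f C k) _) ⟩
    ∑≤ f (λ k → (f C k) * (δ (suc x) a * (((f ∸ k) C j) * readings₂ e c k (f ∸ k ∸ j)))) ∎
    where j = i ∸ 1

  tagged : ColWord → ColWord → List TaggedWord
  tagged u v = shuffles (map (true ,_) u) (map (false ,_) v)

  map-untag-tagged : ∀ u v → map untag (tagged u v) ≡ shuffles u v
  map-untag-tagged u v = trans (map-shuffles proj₂ (map (true ,_) u) (map (false ,_) v))
    (cong₂ shuffles (trans (sym (List.map-∘ u)) (List.map-id u)) (trans (sym (List.map-∘ v)) (List.map-id v)))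

  ∑-tagged-readings₂ : ∀ e u v f g →
    ∑ (tagged u v) (λ c → readings₂ e c f g) ≡ ∑ (unshuffles e) (λ (p , q) → readings p u f * readings q v g)
  ∑-tagged-readings₂ []          []      []      f g = refl
  ∑-tagged-readings₂ []          (_ ∷ _) []      f g = refl
  ∑-tagged-readings₂ []          []      (_ ∷ _) f g = cong (_+ 0) (sym (*-zeroʳ (δ₀ f)))
  ∑-tagged-readings₂ []          (x ∷ u) (y ∷ v) f g =
    trans (∑-shuffles-∷-∷ (λ c → readings₂ [] c f g) (true , x) (map (true ,_) u) (false , y) (map (false ,_) v))
    (cong₂ _+_ (∑-zero (tagged u (y ∷ v)) (λ _ → refl)) (∑-zero (tagged (x ∷ u) v) (λ _ → refl)))
  ∑-tagged-readings₂ (zero ∷ e)  u       v       f g = begin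
    ∑ (tagged u v) (λ c → readings₂ e c (suc f) g + readings₂ e c f (suc g))
      ≡⟨ ∑-+ (tagged u v) _ _ ⟩
    ∑ (tagged u v) (λ c → readings₂ e c (suc f) g) + ∑ (tagged u v) (λ c → readings₂ e c f (suc g))
      ≡⟨ cong₂ _+_ (∑-tagged-readings₂ e u v (suc f) g) (∑-tagged-readings₂ e u v f (suc g)) ⟩
    ∑ (unshuffles e) (λ (p , q) → readings p u (suc f) * readings q v g)
    + ∑ (unshuffles e) (λ (p , q) → readings p u f * readings q v (suc g))
      ≡⟨ ∑-unshuffles-∷ zero e (λ (p , q) → readings p u f * readings q v g) ⟨
    ∑ (unshuffles (zero ∷ e)) (λ (p , q) → readings p u f * readings q v g) ∎
  ∑-tagged-readings₂ (suc x ∷ e) u       v       f g = begin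
    ∑ (tagged u v) (λ c → readings₂ (suc x ∷ e) c f g)
      ≡⟨ ∑-shuffles-∷ (λ c → readings₂ (suc x ∷ e) c f g) refl (map (true ,_) u) (map (false ,_) v) ⟩
    onHead (map (true ,_) u) (λ t c → ∑ (shuffles c (map (false ,_) v)) (λ c′ → readings₂ (suc x ∷ e) (t ∷ c′) f g))
    + onHead (map (false ,_) v) (λ t c → ∑ (shuffles (map (true ,_) u) c) (λ c′ → readings₂ (suc x ∷ e) (t ∷ c′) f g))
      ≡⟨ cong₂ _+_ (fromLeft u) (fromRight v) ⟩
    ∑ (unshuffles e) (λ (p , q) → readings (suc x ∷ p) u f * readings q v g)
    + ∑ (unshuffles e) (λ (p , q) → readings p u f * readings (suc x ∷ q) v g)
      ≡⟨ ∑-unshuffles-∷ (suc x) e (λ (p , q) → readings p u f * readings q v g) ⟨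
    ∑ (unshuffles (suc x ∷ e)) (λ (p , q) → readings p u f * readings q v g) ∎
    where
    factor : ∀ {X : Set} a b (xs : List X) h → ∑ xs (λ t → a * (b * h t)) ≡ a * (b * ∑ xs h)
    factor a b xs h = sym (trans (cong (a *_) (*-distribˡ-∑ xs b h)) (*-distribˡ-∑ xs a _))
    fromLeft : ∀ u → onHead (map (true ,_) u) (λ t c → ∑ (shuffles c (map (false ,_) v)) (λ c′ → readings₂ (suc x ∷ e) (t ∷ c′) f g))
                     ≡ ∑ (unshuffles e) (λ (p , q) → readings (suc x ∷ p) u f * readings q v g)
    fromLeft []            = sym (∑-zero (unshuffles e) (λ _ → refl))
    fromLeft ((a , i) ∷ u) = begin
      ∑ (tagged u v) (λ c → δ (suc x) a * ((f C j) * readings₂ e c (f ∸ j) g))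
        ≡⟨ factor (δ (suc x) a) (f C j) (tagged u v) _ ⟩
      δ (suc x) a * ((f C j) * ∑ (tagged u v) (λ c → readings₂ e c (f ∸ j) g))
        ≡⟨ cong (λ t → δ (suc x) a * ((f C j) * t)) (∑-tagged-readings₂ e u v (f ∸ j) g) ⟩
      δ (suc x) a * ((f C j) * ∑ (unshuffles e) (λ (p , q) → readings p u (f ∸ j) * readings q v g))
        ≡⟨ factor (δ (suc x) a) (f C j) (unshuffles e) _ ⟨
      ∑ (unshuffles e) (λ (p , q) → δ (suc x) a * ((f C j) * (readings p u (f ∸ j) * readings q v g)))
        ≡⟨ ∑-cong (unshuffles e) (λ (p , q) →
             trans (cong (δ (suc x) a *_) (sym (*-assoc (f C j) _ _))) (sym (*-assoc (δ (suc x) a) _ _))) ⟩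
      ∑ (unshuffles e) (λ (p , q) → readings (suc x ∷ p) ((a , i) ∷ u) f * readings q v g) ∎
      where j = i ∸ 1
    fromRight : ∀ v → onHead (map (false ,_) v) (λ t c → ∑ (shuffles (map (true ,_) u) c) (λ c′ → readings₂ (suc x ∷ e) (t ∷ c′) f g))
                      ≡ ∑ (unshuffles e) (λ (p , q) → readings p u f * readings (suc x ∷ q) v g)
    fromRight []            = sym (∑-zero (unshuffles e) (λ (p , q) → *-zeroʳ (readings p u f)))
    fromRight ((b , i) ∷ v) = begin
      ∑ (tagged u v) (λ c → δ (suc x) b * ((g C j) * readings₂ e c f (g ∸ j)))
        ≡⟨ factor (δ (suc x) b) (g C j) (tagged u v) _ ⟩
      δ (suc x) b * ((g C j) * ∑ (tagged u v) (λ c → readings₂ e c f (g ∸ j)))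
        ≡⟨ cong (λ t → δ (suc x) b * ((g C j) * t)) (∑-tagged-readings₂ e u v f (g ∸ j)) ⟩
      δ (suc x) b * ((g C j) * ∑ (unshuffles e) (λ (p , q) → readings p u f * readings q v (g ∸ j)))
        ≡⟨ factor (δ (suc x) b) (g C j) (unshuffles e) _ ⟨
      ∑ (unshuffles e) (λ (p , q) → δ (suc x) b * ((g C j) * (readings p u f * readings q v (g ∸ j))))
        ≡⟨ ∑-cong (unshuffles e) (λ (p , q) → trans (cong (δ (suc x) b *_) (x∙yz≈y∙xz (g C j) (readings p u f) _))
                                                                 (x∙yz≈y∙xz (δ (suc x) b) (readings p u f) _)) ⟩
      ∑ (unshuffles e) (λ (p , q) → readings p u f * readings (suc x ∷ q) ((b , i) ∷ v) g) ∎
      where j = i ∸ 1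

  ∑-shuffles-readings : ∀ e u v →
    ∑ (shuffles u v) (λ c → readings e c 0) ≡ ∑ (unshuffles e) (λ (p , q) → readings p u 0 * readings q v 0)
  ∑-shuffles-readings e u v = begin
    ∑ (shuffles u v) (λ c → readings e c 0)             ≡⟨ cong (λ S → ∑ S (λ c → readings e c 0)) (map-untag-tagged u v) ⟨
    ∑ (map untag (tagged u v)) (λ c → readings e c 0)   ≡⟨ ∑-map untag (tagged u v) _ ⟩
    ∑ (tagged u v) (λ c → readings e (untag c) 0)       ≡⟨ ∑-cong (tagged u v) (λ c → trans (readings-untag e c 0) (+-identityʳ _)) ⟩
    ∑ (tagged u v) (λ c → readings₂ e c 0 0)            ≡⟨ ∑-tagged-readings₂ e u v 0 0 ⟩
    ∑ (unshuffles e) (λ (p , q) → readings p u 0 * readings q v 0) ∎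

module Counting where
  open import Data.Nat
  open import Data.Nat.Properties
  open import Data.List using (List; []; _∷_; _++_; map; concatMap; filter; upTo)
  open import Data.Vec using (Vec; []; _∷_)
  import Data.Vec as Vec
  open import Data.Vec.Relation.Unary.All using (All; []; _∷_)
  open import Defs using (vecs)
  import Data.List.Properties as List
  open import Relation.Nullary using (¬_; Dec; yes; no)
  open import Relation.Unary using (Pred; Decidable)
  open import Relation.Binary.PropositionalEquality
  open import Relation.Binary.Definitions using (Tri; tri<; tri≈; tri>)
  open import Function using (_∘_)
  open Indicator
  open ListSum +-*-commutativeSemiring
  open ≡-Reasoning

  ∑-filter : {A : Set} {P : Pred A _} (P? : Decidable P) (xs : List A) (F : A → ℕ) →
             ∑ (filter P? xs) F ≡ ∑ xs (λ x → 𝟙 (P? x) * F x)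
  ∑-filter P? []       F = refl
  ∑-filter P? (x ∷ xs) F with P? x
  ... | yes _ = cong₂ _+_ (sym (+-identityʳ (F x))) (∑-filter P? xs F)
  ... | no  _ = ∑-filter P? xs F

  ∑-δ-select : ∀ z (xs : List ℕ) (G : ℕ → ℕ) → ∑ xs (λ x → δ z x * G x) ≡ ∑ xs (δ z) * G z
  ∑-δ-select z []       G = refl
  ∑-δ-select z (x ∷ xs) G =
    trans (cong₂ _+_ (δ*-select (z ≟ x)) (∑-δ-select z xs G)) (sym (*-distribʳ-+ (G z) (δ z x) _))
    where
    δ*-select : Dec (z ≡ x) → δ z x * G x ≡ δ z x * G z
    δ*-select (yes refl) = refl
    δ*-select (no z≢x)   = trans (cong (_* G x) (𝟙-no (z ≟ x) z≢x)) (sym (cong (_* G z) (𝟙-no (z ≟ x) z≢x)))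

  ∑-upTo-δ : ∀ z D → ∑ (upTo D) (δ z) ≡ 𝟙 (z <? D)
  ∑-upTo-δ z zero    = refl
  ∑-upTo-δ z (suc D) = begin
    ∑ (upTo (suc D)) (δ z)       ≡⟨ cong (λ l → ∑ l (δ z)) (List.upTo-∷ʳ D) ⟨
    ∑ (upTo D ++ D ∷ []) (δ z)   ≡⟨ ∑-++ (upTo D) (D ∷ []) (δ z) ⟩
    ∑ (upTo D) (δ z) + (δ z D + 0) ≡⟨ cong₂ _+_ (∑-upTo-δ z D) (+-identityʳ (δ z D)) ⟩
    𝟙 (z <? D) + δ z D           ≡⟨ step (<-cmp z D) ⟩
    𝟙 (z <? suc D)               ∎
    where
    _∙_ = trans
    step : Tri (z < D) (z ≡ D) (z > D) → 𝟙 (z <? D) + δ z D ≡ 𝟙 (z <? suc D)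
    step (tri< z<D z≢D _) = cong₂ _+_ (𝟙-yes (z <? D) z<D) (𝟙-no (z ≟ D) z≢D) ∙ sym (𝟙-yes (z <? suc D) (m<n⇒m<1+n z<D))
    step (tri≈ z≮D refl _) = cong₂ _+_ (𝟙-no (z <? D) z≮D) (δ-refl z) ∙ sym (𝟙-yes (z <? suc D) ≤-refl)
    step (tri> _ z≢D D<z) =
      cong₂ _+_ (𝟙-no (z <? D) (<-asym D<z)) (𝟙-no (z ≟ D) z≢D) ∙ sym (𝟙-no (z <? suc D) (<⇒≱ D<z ∘ s≤s⁻¹))

  ∑-filter-implied : {A : Set} {P : Pred A _} (P? : Decidable P) (xs : List A) (F : A → ℕ) →
                     (∀ x → ¬ F x ≡ 0 → P x) → ∑ (filter P? xs) F ≡ ∑ xs F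
  ∑-filter-implied P? xs F F≢0⇒P = trans (∑-filter P? xs F) (∑-cong xs 𝟙*F≡F)
    where
    𝟙*F≡F : ∀ x → 𝟙 (P? x) * F x ≡ F x
    𝟙*F≡F x with F x ≟ 0
    ... | yes F≡0 = trans (cong (𝟙 (P? x) *_) F≡0) (trans (*-zeroʳ (𝟙 (P? x))) (sym F≡0))
    ... | no  F≢0 = trans (cong (_* F x) (𝟙-yes (P? x) (F≢0⇒P x F≢0))) (+-identityʳ (F x))

  ∑-upTo-δ-member : ∀ D j → j < D → ∑ (upTo D) (λ y → δ y j) ≡ 1
  ∑-upTo-δ-member D j j<D =
    trans (∑-cong (upTo D) (λ y → δ-sym y j)) (trans (∑-upTo-δ j D) (𝟙-yes (j <? D) j<D))

  ∑-vecs-δⱽ : ∀ {A : Set} k (xs : List A) (g : A → ℕ) (t : Vec ℕ k) →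
              All (λ tᵢ → ∑ xs (λ x → δ (g x) tᵢ) ≡ 1) t → ∑ (vecs k xs) (λ v → δⱽ (Vec.map g v) t) ≡ 1
  ∑-vecs-δⱽ zero    xs g []      []         = refl
  ∑-vecs-δⱽ (suc k) xs g (tᵢ ∷ t) (eᵢ ∷ es) = begin
    ∑ (concatMap (λ x → map (x ∷_) (vecs k xs)) xs) (λ v → δⱽ (Vec.map g v) (tᵢ ∷ t))
      ≡⟨ ∑-concatMap _ xs _ ⟩
    ∑ xs (λ x → ∑ (map (x ∷_) (vecs k xs)) (λ v → δⱽ (Vec.map g v) (tᵢ ∷ t)))
      ≡⟨ ∑-cong xs (λ x → ∑-map (x ∷_) (vecs k xs) _) ⟩
    ∑ xs (λ x → ∑ (vecs k xs) (λ v → δⱽ (g x ∷ Vec.map g v) (tᵢ ∷ t)))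
      ≡⟨ ∑-cong xs (λ x → trans (∑-cong (vecs k xs) (λ v → δⱽ-∷ (g x) tᵢ (Vec.map g v) t))
                                (sym (*-distribˡ-∑ (vecs k xs) (δ (g x) tᵢ) _))) ⟩
    ∑ xs (λ x → δ (g x) tᵢ * ∑ (vecs k xs) (λ v → δⱽ (Vec.map g v) t))
      ≡⟨ ∑-cong xs (λ x → trans (cong (δ (g x) tᵢ *_) (∑-vecs-δⱽ k xs g t es)) (*-identityʳ _)) ⟩
    ∑ xs (λ x → δ (g x) tᵢ)
      ≡⟨ eᵢ ⟩
    1 ∎

module Parse where
  open import Data.Nat
  open import Data.Nat.Properties
  open import Data.Nat.Combinatorics using (_C_; k>n⇒nCk≡0)
  open import Data.Nat.Tactic.RingSolver using (solve-∀)
  open import Data.Empty using (⊥; ⊥-elim)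
  open import Data.Unit using (⊤; tt)
  open import Data.Product using (Σ; _×_; _,_; proj₂)
  open import Data.List using (List; []; _∷_; _++_; map; concatMap; length; upTo)
  import Data.List.Properties as List
  open import Data.List.Relation.Unary.All using ([]; _∷_) renaming (All to Allᴸ)
  import Data.Nat.ListAction as ListAction
  open import Data.Vec using (Vec; toList; zipWith; sum; []; _∷_)
  open import Data.Vec.Relation.Unary.All using (All; []; _∷_)
  open import Relation.Nullary using (¬_; Dec; yes; no)
  open import Relation.Binary.PropositionalEquality
  open import Defs using (ColWord; zeros; eps; vecs; comps; cAux; cIJ; IsComp; shuffles; occ)
  open Shuffle using (unshuffles; ∑-shuffles-δ⋆)
  open Indicator
  open Counting
  open Readings
  open ListSum +-*-commutativeSemiring
  open import Algebra.Properties.CommutativeSemigroup *-commutativeSemigroup using (x∙yz≈y∙xz)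
  open ≡-Reasoning

  colored : ∀ {k} → Vec ℕ k → Vec ℕ k → ColWord
  colored ls I = toList (zipWith _,_ ls I)

  weight : ColWord → ℕ
  weight u = ListAction.sum (map proj₂ u)

  PositiveColors : ColWord → Set
  PositiveColors = Allᴸ (λ p → 1 ≤ proj₂ p)

  colored-positive : ∀ {k} (ls I : Vec ℕ k) → IsComp I → PositiveColors (colored ls I)
  colored-positive []       []       []         = []
  colored-positive (l ∷ ls) (i ∷ I) (1≤i ∷ cI) = 1≤i ∷ colored-positive ls I cI

  weight-colored : ∀ {k} (ls I : Vec ℕ k) → weight (colored ls I) ≡ sum I
  weight-colored []       []      = refl
  weight-colored (l ∷ ls) (i ∷ I) = cong (i +_) (weight-colored ls I)

  NoLeadingZero : List ℕ → Set
  NoLeadingZero []          = ⊤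
  NoLeadingZero (zero ∷ _)  = ⊥
  NoLeadingZero (suc _ ∷ _) = ⊤

  split-leading-zeros : ∀ a → Σ ℕ λ z → Σ (List ℕ) λ r → a ≡ zeros z ++ r × NoLeadingZero r
  split-leading-zeros []          = 0 , [] , refl , tt
  split-leading-zeros (suc x ∷ a) = 0 , suc x ∷ a , refl , tt
  split-leading-zeros (zero ∷ a) with split-leading-zeros a
  ... | z , r , a≡ , nlz = suc z , r , cong (zero ∷_) a≡ , nlz

  δ⋆-zeros-++ : ∀ z x r l e → NoLeadingZero r → 1 ≤ l →
                δ⋆ (zeros z ++ r) (zeros x ++ (l ∷ e)) ≡ δ z x * δ⋆ r (l ∷ e)
  δ⋆-zeros-++ zero    zero    r           l       e _ _ = sym (+-identityʳ _)
  δ⋆-zeros-++ zero    (suc x) []          l       e _ _ = refl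
  δ⋆-zeros-++ zero    (suc x) (suc y ∷ r) l       e _ _ = δ⋆-∷ (suc y) 0 r (zeros x ++ (l ∷ e))
  δ⋆-zeros-++ (suc z) zero    r           (suc l) e _ _ = δ⋆-∷ 0 (suc l) (zeros z ++ r) e
  δ⋆-zeros-++ (suc z) (suc x) r           l       e nlz 1≤l = begin
    δ⋆ (0 ∷ zeros z ++ r) (0 ∷ zeros x ++ (l ∷ e)) ≡⟨ δ⋆-∷ 0 0 (zeros z ++ r) _ ⟩
    1 * δ⋆ (zeros z ++ r) (zeros x ++ (l ∷ e))     ≡⟨ *-identityˡ _ ⟩
    δ⋆ (zeros z ++ r) (zeros x ++ (l ∷ e))         ≡⟨ δ⋆-zeros-++ z x r l e nlz 1≤l ⟩
    δ z x * δ⋆ r (l ∷ e)                           ≡⟨ cong (_* δ⋆ r (l ∷ e)) (δ-suc z x) ⟨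
    δ (suc z) (suc x) * δ⋆ r (l ∷ e)               ∎

  readings-zeros-++ : ∀ z r u f → readings (zeros z ++ r) u f ≡ readings r u (z + f)
  readings-zeros-++ zero    r u f = refl
  readings-zeros-++ (suc z) r u f = trans (readings-zeros-++ z r u (suc f)) (cong (readings r u) (+-suc z f))

  length-zeros : ∀ z → length (zeros z) ≡ z
  length-zeros zero    = refl
  length-zeros (suc z) = cong suc (length-zeros z)

  readings-[] : ∀ a f → readings a [] (suc f) ≡ 0
  readings-[] []          f = refl
  readings-[] (zero ∷ a)  f = readings-[] a (suc f)
  readings-[] (suc x ∷ a) f = refl

  -- Every letter of a reading accounts for one unit of weight: a zero or a nonzero letter.
  readings≢0⇒length+f≡weight : ∀ a u f → PositiveColors u → ¬ readings a u f ≡ 0 → length a + f ≡ weight u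
  readings≢0⇒length+f≡weight []          []            zero    _ _ = refl
  readings≢0⇒length+f≡weight []          []            (suc f) _ ≢0 = ⊥-elim (≢0 refl)
  readings≢0⇒length+f≡weight []          (_ ∷ _)       f       _ ≢0 = ⊥-elim (≢0 refl)
  readings≢0⇒length+f≡weight (zero ∷ a)  u             f       pos ≢0 =
    trans (sym (+-suc (length a) f)) (readings≢0⇒length+f≡weight a u (suc f) pos ≢0)
  readings≢0⇒length+f≡weight (suc x ∷ a) []            f       _ ≢0 = ⊥-elim (≢0 refl)
  readings≢0⇒length+f≡weight (suc x ∷ a) ((l , i) ∷ u) f       (1≤i ∷ pos) ≢0 = begin
    suc (length a + f)                ≡⟨ cong (λ t → suc (length a + t)) (sym (m∸n+n≡m j≤f)) ⟩
    suc (length a + (f ∸ j + j))      ≡⟨ cong suc (sym (+-assoc (length a) _ _)) ⟩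
    suc (length a + (f ∸ j) + j)      ≡⟨ cong (λ t → suc (t + j)) (readings≢0⇒length+f≡weight a u (f ∸ j) pos R≢0) ⟩
    suc (weight u + j)                ≡⟨ cong suc (+-comm (weight u) j) ⟩
    suc j + weight u                  ≡⟨ cong (_+ weight u) (suc-pred i {{>-nonZero 1≤i}}) ⟩
    i + weight u                      ∎
    where
    j = i ∸ 1
    C≢0 : ¬ (f C j) ≡ 0
    C≢0 e = ≢0 (trans (cong (λ t → δ (suc x) l * (t * readings a u (f ∸ j))) e) (*-zeroʳ (δ (suc x) l)))
    R≢0 : ¬ readings a u (f ∸ j) ≡ 0
    R≢0 e = ≢0 (trans (cong (λ t → δ (suc x) l * ((f C j) * t)) e)
                    (trans (cong (δ (suc x) l *_) (*-zeroʳ (f C j))) (*-zeroʳ (δ (suc x) l))))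
    j≤f : j ≤ f
    j≤f with j ≤? f
    ... | yes j≤f = j≤f
    ... | no  j≰f = ⊥-elim (C≢0 (k>n⇒nCk≡0 (≰⇒> j≰f)))

  -- With pI + f letters of ε already read, a part j of J ends at position pI + f + j,
  -- leaving (j ∸ 1) + f zeros pending; a block of size i uses i ∸ 1 of them.
  pending-zeros : ∀ pI f j → 1 ≤ j → pI + f + j ∸ pI ∸ 1 ≡ j ∸ 1 + f
  pending-zeros pI f (suc j) _ = begin
    pI + f + suc j ∸ pI ∸ 1     ≡⟨ cong (λ t → t ∸ pI ∸ 1) (+-assoc pI f (suc j)) ⟩
    pI + (f + suc j) ∸ pI ∸ 1   ≡⟨ cong (_∸ 1) (m+n∸m≡n pI (f + suc j)) ⟩
    f + suc j ∸ 1               ≡⟨ cong (_∸ 1) (+-suc f j) ⟩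
    f + j                       ≡⟨ +-comm f j ⟩
    j + f                       ∎

  next-offset : ∀ pI f i j → 1 ≤ i → 1 ≤ j → i ∸ 1 ≤ j ∸ 1 + f →
                pI + f + j ≡ pI + i + (j ∸ 1 + f ∸ (i ∸ 1))
  next-offset pI f (suc i) (suc j) _ _ i≤j+f = begin
    pI + f + suc j               ≡⟨ +-assoc pI f (suc j) ⟩
    pI + (f + suc j)             ≡⟨ cong (pI +_) (trans (+-suc f j) (cong suc (+-comm f j))) ⟩
    pI + suc (j + f)             ≡⟨ cong (λ t → pI + suc t) (m+[n∸m]≡n i≤j+f) ⟨
    pI + (suc i + (j + f ∸ i))   ≡⟨ +-assoc pI (suc i) _ ⟨
    pI + suc i + (j + f ∸ i)     ∎

  readings-many-zeros : ∀ z x r u f D → PositiveColors u → weight u ≤ f + D → D ≤ z →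
                        readings (zeros z ++ (x ∷ r)) u f ≡ 0
  readings-many-zeros z x r u f D pos u≤f+D D≤z with readings (zeros z ++ (x ∷ r)) u f ≟ 0
  ... | yes ≡0 = ≡0
  ... | no  ≢0 = ⊥-elim (<-irrefl refl (≤-<-trans (+-monoʳ-≤ f D≤z)
      (<-≤-trans (+-monoʳ-< f (m<m+n z (s≤s z≤n))) (≤-trans (≤-reflexive f+length≡weight) u≤f+D))))
    where
    f+length≡weight : f + (z + length (x ∷ r)) ≡ weight u
    f+length≡weight = begin
      f + (z + length (x ∷ r))         ≡⟨ +-comm f _ ⟩
      z + length (x ∷ r) + f           ≡⟨ cong (_+ f) (trans (List.length-++ (zeros z)) (cong (_+ length (x ∷ r)) (length-zeros z))) ⟨
      length (zeros z ++ (x ∷ r)) + f  ≡⟨ readings≢0⇒length+f≡weight (zeros z ++ (x ∷ r)) u f pos ≢0 ⟩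
      weight u                         ∎

  -- The sum over the compositions J of T ∸ pJ with parts at most D, once leading parts of I and J
  -- with sums pI and pJ have been matched; pJ ∸ pI zeros are then pending.
  parseSum : ∀ k → Vec ℕ k → Vec ℕ k → (pI pJ T D : ℕ) → List ℕ → ℕ
  parseSum k ls I pI pJ T D a =
    ∑ (vecs k (map suc (upTo D))) (λ J → 𝟙 (pJ + sum J ≟ T) * (cAux pI pJ I J * δ⋆ a (eps ls J)))

  parseSum-[] : ∀ pI f D a → parseSum 0 [] [] pI (pI + f) pI D a ≡ readings a [] f
  parseSum-[] pI f D a = trans (+-identityʳ _) (go a)
    where
    𝟙≡δ₀ : ∀ f → 𝟙 (pI + f + 0 ≟ pI) ≡ δ₀ f
    𝟙≡δ₀ zero    = 𝟙-yes (pI + 0 + 0 ≟ pI) (trans (+-identityʳ _) (+-identityʳ pI))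
    𝟙≡δ₀ (suc f) = 𝟙-no (pI + suc f + 0 ≟ pI)
      (λ e → 1+n≢0 (+-cancelˡ-≡ pI (suc f) 0 (trans (sym (+-identityʳ _)) (trans e (sym (+-identityʳ pI))))))
    go : ∀ a → 𝟙 (pI + f + 0 ≟ pI) * (1 * δ⋆ a []) ≡ readings a [] f
    go []          = trans (*-identityʳ _) (𝟙≡δ₀ f)
    go (zero ∷ a)  = trans (*-zeroʳ (𝟙 (pI + f + 0 ≟ pI))) (sym (readings-[] a f))
    go (suc x ∷ a) = *-zeroʳ (𝟙 (pI + f + 0 ≟ pI))

  -- A word with z leading zeros can only match the ε-words whose first part is z + 1.
  module FirstPart {k} (l i : ℕ) (ls I : Vec ℕ k) (pI pJ T D : ℕ) where

    parts : List ℕ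
    parts = map suc (upTo D)

    rest : ℕ → List ℕ → ℕ
    rest z r = ∑ (vecs k parts) (λ J → 𝟙 (pJ + suc z + sum J ≟ T) * (cAux (pI + i) (pJ + suc z) I J * δ⋆ r (l ∷ eps ls J)))

    parseSum-zeros-++ : ∀ z r → NoLeadingZero r → 1 ≤ l →
      parseSum (suc k) (l ∷ ls) (i ∷ I) pI pJ T D (zeros z ++ r) ≡ 𝟙 (z <? D) * ((((pJ + suc z) ∸ pI ∸ 1) C (i ∸ 1)) * rest z r)
    parseSum-zeros-++ z r nlz 1≤l = begin
      ∑ (concatMap (λ x → map (x ∷_) (vecs k parts)) parts) Φ
        ≡⟨ ∑-concatMap (λ x → map (x ∷_) (vecs k parts)) parts Φ ⟩
      ∑ parts (λ x → ∑ (map (x ∷_) (vecs k parts)) Φ)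
        ≡⟨ ∑-cong parts (λ x → ∑-map (x ∷_) (vecs k parts) Φ) ⟩
      ∑ parts (λ x → ∑ (vecs k parts) (λ J → Φ (x ∷ J)))
        ≡⟨ ∑-map suc (upTo D) _ ⟩
      ∑ (upTo D) (λ x → ∑ (vecs k parts) (λ J → Φ (suc x ∷ J)))
        ≡⟨ ∑-cong (upTo D) (λ x → trans (∑-cong (vecs k parts) (Φ≡ x)) (factor x)) ⟩
      ∑ (upTo D) (λ x → δ z x * G x)
        ≡⟨ ∑-δ-select z (upTo D) G ⟩
      ∑ (upTo D) (δ z) * G z
        ≡⟨ cong (_* G z) (∑-upTo-δ z D) ⟩
      𝟙 (z <? D) * G z ∎
      where
      c : ℕ → ℕ
      c x = ((pJ + suc x) ∸ pI ∸ 1) C (i ∸ 1)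
      Φ : Vec ℕ (suc k) → ℕ
      Φ J = 𝟙 (pJ + sum J ≟ T) * (cAux pI pJ (i ∷ I) J * δ⋆ (zeros z ++ r) (eps (l ∷ ls) J))
      G : ℕ → ℕ
      G x = c x * rest x r
      regroup : ∀ a b e d f → a * (b * e * (d * f)) ≡ d * (b * (a * (e * f)))
      regroup = solve-∀
      Φ≡ : ∀ x J → Φ (suc x ∷ J) ≡ δ z x * (c x * (𝟙 (pJ + suc x + sum J ≟ T) * (cAux (pI + i) (pJ + suc x) I J * δ⋆ r (l ∷ eps ls J))))
      Φ≡ x J = trans (cong₂ (λ t e → 𝟙 (t ≟ T) * (c x * cAux (pI + i) (pJ + suc x) I J * e))
                            (sym (+-assoc pJ (suc x) (sum J))) (δ⋆-zeros-++ z x r l (eps ls J) nlz 1≤l))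
                     (regroup (𝟙 (pJ + suc x + sum J ≟ T)) (c x) (cAux (pI + i) (pJ + suc x) I J) (δ z x) _)
      factor : ∀ x → ∑ (vecs k parts) (λ J → δ z x * (c x * (𝟙 (pJ + suc x + sum J ≟ T) * (cAux (pI + i) (pJ + suc x) I J * δ⋆ r (l ∷ eps ls J)))))
                     ≡ δ z x * G x
      factor x = sym (trans (cong (δ z x *_) (*-distribˡ-∑ (vecs k parts) (c x) _)) (*-distribˡ-∑ (vecs k parts) (δ z x) _))

    rest-[] : ∀ z → rest z [] ≡ 0
    rest-[] z = ∑-zero (vecs k parts) (λ J → trans (cong (𝟙 (pJ + suc z + sum J ≟ T) *_) (*-zeroʳ (cAux (pI + i) (pJ + suc z) I J)))
                                                  (*-zeroʳ (𝟙 (pJ + suc z + sum J ≟ T))))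

    rest-∷ : ∀ z y r → rest z (suc y ∷ r) ≡ δ (suc y) l * parseSum k ls I (pI + i) (pJ + suc z) T D r
    rest-∷ z y r = trans (∑-cong (vecs k parts) (λ J → trans
        (cong (λ t → 𝟙 (pJ + suc z + sum J ≟ T) * (cAux (pI + i) (pJ + suc z) I J * t)) (δ⋆-∷ (suc y) l r (eps ls J)))
        (regroup (𝟙 (pJ + suc z + sum J ≟ T)) (cAux (pI + i) (pJ + suc z) I J) (δ (suc y) l) (δ⋆ r (eps ls J)))))
      (sym (*-distribˡ-∑ (vecs k parts) (δ (suc y) l) _))
      where
      regroup : ∀ a b d e → a * (b * (d * e)) ≡ d * (a * (b * e))
      regroup = solve-∀

  parseSum≡readings : ∀ k (ls I : Vec ℕ k) → All (1 ≤_) ls → IsComp I → ∀ pI f D a → pI + sum I ≤ pI + f + D →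
    parseSum k ls I pI (pI + f) (pI + sum I) D a ≡ readings a (colored ls I) f
  parseSum≡readings zero    [] []                     []          []           pI f D a _ =
    subst (λ T → parseSum 0 [] [] pI (pI + f) T D a ≡ readings a [] f) (sym (+-identityʳ pI)) (parseSum-[] pI f D a)
  parseSum≡readings (suc k) (l ∷ ls) (i ∷ I) (1≤l ∷ 1≤ls) (1≤i ∷ cI) pI f D a T≤pJ+D
    with split-leading-zeros a
  ... | z , r , refl , nlz = begin
    parseSum (suc k) (l ∷ ls) (i ∷ I) pI pJ T D (zeros z ++ r)   ≡⟨ parseSum-zeros-++ z r nlz 1≤l ⟩
    𝟙 (z <? D) * (c₀ * rest z r)      ≡⟨ by-cases (z <? D) r refl ⟩
    readings (zeros z ++ r) (colored (l ∷ ls) (i ∷ I)) f         ∎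
    where
    open FirstPart l i ls I pI (pI + f) (pI + (i + sum I)) D
    T = pI + (i + sum I)
    pJ = pI + f
    j = i ∸ 1
    u = colored ls I
    c₀ = ((pJ + suc z) ∸ pI ∸ 1) C j
    recurse : ∀ r → Dec (j ≤ z + f) → ((z + f) C j) * parseSum k ls I (pI + i) (pJ + suc z) T D r
                                     ≡ ((z + f) C j) * readings r u (z + f ∸ j)
    recurse r (no j≰) = trans (cong (_* parseSum k ls I (pI + i) (pJ + suc z) T D r) (k>n⇒nCk≡0 (≰⇒> j≰)))
                              (sym (cong (_* readings r u (z + f ∸ j)) (k>n⇒nCk≡0 (≰⇒> j≰))))
    recurse r (yes j≤) = cong (((z + f) C j) *_) (begin
      parseSum k ls I (pI + i) (pJ + suc z) T D r
        ≡⟨ cong₂ (λ p t → parseSum k ls I (pI + i) p t D r) pJ′≡ (sym (+-assoc pI i (sum I))) ⟩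
      parseSum k ls I (pI + i) (pI + i + (z + f ∸ j)) (pI + i + sum I) D r
        ≡⟨ parseSum≡readings k ls I 1≤ls cI (pI + i) (z + f ∸ j) D r bound ⟩
      readings r u (z + f ∸ j) ∎)
      where
      pJ′≡ : pJ + suc z ≡ pI + i + (z + f ∸ j)
      pJ′≡ = next-offset pI f i (suc z) 1≤i (s≤s z≤n) j≤
      bound : pI + i + sum I ≤ pI + i + (z + f ∸ j) + D
      bound = ≤-trans (≤-reflexive (+-assoc pI i (sum I)))
                (≤-trans T≤pJ+D (≤-trans (+-monoˡ-≤ D (m≤m+n pJ (suc z))) (≤-reflexive (cong (_+ D) pJ′≡))))
    by-cases : Dec (z < D) → ∀ r₀ → r ≡ r₀ →
      𝟙 (z <? D) * (c₀ * rest z r₀) ≡ readings (zeros z ++ r₀) (colored (l ∷ ls) (i ∷ I)) f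
    by-cases (no z≮D) []        refl = trans (cong (_* (c₀ * rest z [])) (𝟙-no (z <? D) z≮D)) (sym (readings-zeros-++ z [] _ f))
    by-cases (no z≮D) (x ∷ r′) refl = trans (cong (_* (c₀ * rest z (x ∷ r′))) (𝟙-no (z <? D) z≮D))
      (sym (readings-many-zeros z x r′ _ f D (1≤i ∷ colored-positive ls I cI) weight≤ (≮⇒≥ z≮D)))
      where
      weight≤ : i + weight u ≤ f + D
      weight≤ = +-cancelˡ-≤ pI _ _ (subst₂ _≤_ (cong (λ t → pI + (i + t)) (sym (weight-colored ls I))) (+-assoc pI f D) T≤pJ+D)
    by-cases (yes z<D) []          refl = begin
      𝟙 (z <? D) * (c₀ * rest z [])   ≡⟨ cong (λ t → 𝟙 (z <? D) * (c₀ * t)) (rest-[] z) ⟩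
      𝟙 (z <? D) * (c₀ * 0)           ≡⟨ cong (𝟙 (z <? D) *_) (*-zeroʳ c₀) ⟩
      𝟙 (z <? D) * 0                                             ≡⟨ *-zeroʳ (𝟙 (z <? D)) ⟩
      0                                                          ≡⟨ readings-zeros-++ z [] _ f ⟨
      readings (zeros z ++ []) (colored (l ∷ ls) (i ∷ I)) f      ∎
    by-cases (yes z<D) (suc y ∷ r′) refl = begin
      𝟙 (z <? D) * (c₀ * rest z (suc y ∷ r′))
        ≡⟨ cong₂ (λ a b → a * (b * rest z (suc y ∷ r′))) (𝟙-yes (z <? D) z<D) (cong (_C j) (pending-zeros pI f (suc z) (s≤s z≤n))) ⟩
      1 * (((z + f) C j) * rest z (suc y ∷ r′))
        ≡⟨ *-identityˡ _ ⟩
      ((z + f) C j) * rest z (suc y ∷ r′)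
        ≡⟨ cong (((z + f) C j) *_) (rest-∷ z y r′) ⟩
      ((z + f) C j) * (δ (suc y) l * parseSum k ls I (pI + i) (pJ + suc z) T D r′)
        ≡⟨ x∙yz≈y∙xz ((z + f) C j) (δ (suc y) l) _ ⟩
      δ (suc y) l * (((z + f) C j) * parseSum k ls I (pI + i) (pJ + suc z) T D r′)
        ≡⟨ cong (δ (suc y) l *_) (recurse r′ (j ≤? z + f)) ⟩
      δ (suc y) l * (((z + f) C j) * readings r′ u (z + f ∸ j))
        ≡⟨ readings-zeros-++ z (suc y ∷ r′) _ f ⟨
      readings (zeros z ++ (suc y ∷ r′)) (colored (l ∷ ls) (i ∷ I)) f ∎

  readings-colored : ∀ k (ls I : Vec ℕ k) → All (1 ≤_) ls → IsComp I → ∀ a →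
    ∑ (comps k (sum I)) (λ J → cIJ I J * δ⋆ a (eps ls J)) ≡ readings a (colored ls I) 0
  readings-colored k ls I 1≤ls cI a =
    trans (∑-filter (λ J → sum J ≟ sum I) (vecs k (map suc (upTo (sum I)))) _)
          (parseSum≡readings k ls I 1≤ls cI 0 0 (sum I) a ≤-refl)

  readings-eps : ∀ k (ls ls′ I J : Vec ℕ k) → All (1 ≤_) ls → IsComp I → IsComp J → ∀ pI f →
    pI + sum I ≡ pI + f + sum J → readings (eps ls J) (colored ls′ I) f ≡ δⱽ ls ls′ * cAux pI (pI + f) I J
  readings-eps zero [] [] [] [] _ _ _ pI zero    _ = refl
  readings-eps zero [] [] [] [] _ _ _ pI (suc f) e with +-cancelˡ-≡ pI (suc f) 0 (trans (sym (+-identityʳ _)) (sym e))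
  ... | ()
  readings-eps (suc k) (suc l ∷ ls) (l′ ∷ ls′) (i ∷ I) (j ∷ J) (_ ∷ 1≤ls) (1≤i ∷ cI) (1≤j ∷ cJ) pI f e = begin
    readings (zeros (j ∸ 1) ++ (suc l ∷ eps ls J)) ((l′ , i) ∷ colored ls′ I) f
      ≡⟨ readings-zeros-++ (j ∸ 1) _ _ f ⟩
    δ (suc l) l′ * ((f′ C (i ∸ 1)) * readings (eps ls J) (colored ls′ I) (f′ ∸ (i ∸ 1)))
      ≡⟨ cong (δ (suc l) l′ *_) (recurse (i ∸ 1 ≤? f′)) ⟩
    δ (suc l) l′ * ((f′ C (i ∸ 1)) * (δⱽ ls ls′ * cAux (pI + i) (pI + f + j) I J))
      ≡⟨ cong (λ t → δ (suc l) l′ * ((t C (i ∸ 1)) * (δⱽ ls ls′ * cAux (pI + i) (pI + f + j) I J))) (pending-zeros pI f j 1≤j) ⟨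
    δ (suc l) l′ * ((c₀ C (i ∸ 1)) * (δⱽ ls ls′ * cAux (pI + i) (pI + f + j) I J))
      ≡⟨ regroup (δ (suc l) l′) ((c₀ C (i ∸ 1))) (δⱽ ls ls′) (cAux (pI + i) (pI + f + j) I J) ⟩
    δ (suc l) l′ * δⱽ ls ls′ * ((c₀ C (i ∸ 1)) * cAux (pI + i) (pI + f + j) I J)
      ≡⟨ cong (_* _) (δⱽ-∷ (suc l) l′ ls ls′) ⟨
    δⱽ (suc l ∷ ls) (l′ ∷ ls′) * cAux pI (pI + f) (i ∷ I) (j ∷ J) ∎
    where
    f′ = j ∸ 1 + f
    c₀ = pI + f + j ∸ pI ∸ 1
    regroup : ∀ a b c d → a * (b * (c * d)) ≡ a * c * (b * d)
    regroup = solve-∀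
    recurse : Dec (i ∸ 1 ≤ f′) → (f′ C (i ∸ 1)) * readings (eps ls J) (colored ls′ I) (f′ ∸ (i ∸ 1))
                               ≡ (f′ C (i ∸ 1)) * (δⱽ ls ls′ * cAux (pI + i) (pI + f + j) I J)
    recurse (no  i≰) = trans (cong (_* readings (eps ls J) (colored ls′ I) (f′ ∸ (i ∸ 1))) (k>n⇒nCk≡0 (≰⇒> i≰)))
                             (sym (cong (_* (δⱽ ls ls′ * cAux (pI + i) (pI + f + j) I J)) (k>n⇒nCk≡0 (≰⇒> i≰))))
    recurse (yes i≤) = cong ((f′ C (i ∸ 1)) *_) (begin
      readings (eps ls J) (colored ls′ I) (f′ ∸ (i ∸ 1))
        ≡⟨ readings-eps k ls ls′ I J 1≤ls cI cJ (pI + i) (f′ ∸ (i ∸ 1)) sums ⟩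
      δⱽ ls ls′ * cAux (pI + i) (pI + i + (f′ ∸ (i ∸ 1))) I J
        ≡⟨ cong (λ p → δⱽ ls ls′ * cAux (pI + i) p I J) offset ⟨
      δⱽ ls ls′ * cAux (pI + i) (pI + f + j) I J ∎)
      where
      offset = next-offset pI f i j 1≤i 1≤j i≤
      sums : pI + i + sum I ≡ pI + i + (f′ ∸ (i ∸ 1)) + sum J
      sums = begin
        pI + i + sum I                    ≡⟨ +-assoc pI i (sum I) ⟩
        pI + (i + sum I)                  ≡⟨ e ⟩
        pI + f + (j + sum J)              ≡⟨ +-assoc (pI + f) j (sum J) ⟨
        pI + f + j + sum J                ≡⟨ cong (_+ sum J) offset ⟩
        pI + i + (f′ ∸ (i ∸ 1)) + sum J   ∎

  ∑-shuffles-colored : ∀ n m (ls₁ I₁ : Vec ℕ n) (ls₂ I₂ : Vec ℕ m) →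
    All (1 ≤_) ls₁ → IsComp I₁ → All (1 ≤_) ls₂ → IsComp I₂ → ∀ w →
    ∑ (shuffles (colored ls₁ I₁) (colored ls₂ I₂)) (λ c → readings w c 0)
    ≡ ∑ (comps n (sum I₁)) (λ A → ∑ (comps m (sum I₂)) (λ B →
        cIJ I₁ A * cIJ I₂ B * occ w (shuffles (eps ls₁ A) (eps ls₂ B))))
  ∑-shuffles-colored n m ls₁ I₁ ls₂ I₂ 1≤ls₁ cI₁ 1≤ls₂ cI₂ w = sym (begin
    ∑ C₁ (λ A → ∑ C₂ (λ B → cIJ I₁ A * cIJ I₂ B * occ w (shuffles (eps ls₁ A) (eps ls₂ B))))
      ≡⟨ ∑-cong C₁ (λ A → ∑-cong C₂ (λ B → cong (cIJ I₁ A * cIJ I₂ B *_)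
           (trans (occ≡∑δ⋆ w (shuffles (eps ls₁ A) (eps ls₂ B))) (∑-shuffles-δ⋆ w (eps ls₁ A) (eps ls₂ B))))) ⟩
    ∑ C₁ (λ A → ∑ C₂ (λ B → cIJ I₁ A * cIJ I₂ B * ∑ (unshuffles w) (λ (p , q) → δ⋆ p (eps ls₁ A) * δ⋆ q (eps ls₂ B))))
      ≡⟨ ∑-cong C₁ (λ A → ∑-cong C₂ (λ B → *-distribˡ-∑ (unshuffles w) (cIJ I₁ A * cIJ I₂ B) _)) ⟩
    ∑ C₁ (λ A → ∑ C₂ (λ B → ∑ (unshuffles w) (λ (p , q) → cIJ I₁ A * cIJ I₂ B * (δ⋆ p (eps ls₁ A) * δ⋆ q (eps ls₂ B)))))
      ≡⟨ ∑-cong C₁ (λ A → ∑-comm C₂ (unshuffles w) _) ⟩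
    ∑ C₁ (λ A → ∑ (unshuffles w) (λ (p , q) → ∑ C₂ (λ B → cIJ I₁ A * cIJ I₂ B * (δ⋆ p (eps ls₁ A) * δ⋆ q (eps ls₂ B)))))
      ≡⟨ ∑-comm C₁ (unshuffles w) _ ⟩
    ∑ (unshuffles w) (λ (p , q) → ∑ C₁ (λ A → ∑ C₂ (λ B → cIJ I₁ A * cIJ I₂ B * (δ⋆ p (eps ls₁ A) * δ⋆ q (eps ls₂ B)))))
      ≡⟨ ∑-cong (unshuffles w) (λ (p , q) → ∑-cong C₁ (λ A → trans
           (∑-cong C₂ (λ B → interchange (cIJ I₁ A) (cIJ I₂ B) (δ⋆ p (eps ls₁ A)) (δ⋆ q (eps ls₂ B))))
           (sym (*-distribˡ-∑ C₂ (cIJ I₁ A * δ⋆ p (eps ls₁ A)) (λ B → cIJ I₂ B * δ⋆ q (eps ls₂ B)))))) ⟩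
    ∑ (unshuffles w) (λ (p , q) → ∑ C₁ (λ A → cIJ I₁ A * δ⋆ p (eps ls₁ A) * ∑ C₂ (λ B → cIJ I₂ B * δ⋆ q (eps ls₂ B))))
      ≡⟨ ∑-cong (unshuffles w) (λ (p , q) → *-distribʳ-∑ C₁ _ (λ A → cIJ I₁ A * δ⋆ p (eps ls₁ A))) ⟨
    ∑ (unshuffles w) (λ (p , q) → ∑ C₁ (λ A → cIJ I₁ A * δ⋆ p (eps ls₁ A)) * ∑ C₂ (λ B → cIJ I₂ B * δ⋆ q (eps ls₂ B)))
      ≡⟨ ∑-cong (unshuffles w) (λ (p , q) → cong₂ _*_ (readings-colored n ls₁ I₁ 1≤ls₁ cI₁ p) (readings-colored m ls₂ I₂ 1≤ls₂ cI₂ q)) ⟩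
    ∑ (unshuffles w) (λ (p , q) → readings p (colored ls₁ I₁) 0 * readings q (colored ls₂ I₂) 0)
      ≡⟨ ∑-shuffles-readings w (colored ls₁ I₁) (colored ls₂ I₂) ⟨
    ∑ (shuffles (colored ls₁ I₁) (colored ls₂ I₂)) (λ c → readings w c 0) ∎)
    where
    C₁ = comps n (sum I₁)
    C₂ = comps m (sum I₂)
    interchange : ∀ a b c d → a * b * (c * d) ≡ a * c * (b * d)
    interchange = solve-∀

module Enumeration where
  open import Data.Nat
  open import Data.Nat.Properties
  open import Data.Fin as Fin using (Fin; toℕ)
  import Data.Fin.Properties as Fin
  open import Data.Product using (_×_; _,_)
  open import Data.List using (List; []; _∷_; map; upTo; allFin; tabulate; applyUpTo)
  import Data.List.Properties as List
  open import Data.List.Relation.Unary.All as Allᴸ using ([]; _∷_) renaming (All to Allᴸ)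
  import Data.List.Relation.Unary.All.Properties as Allᴸ
  open import Data.Vec using (Vec; []; _∷_; sum)
  import Data.Vec as Vec
  import Data.Vec.Properties as Vec
  open import Data.Vec.Relation.Unary.All as All using (All; []; _∷_)
  import Data.Vec.Relation.Unary.All.Properties as AllV
  open import Function using (_∘_)
  open import Relation.Nullary using (¬_)
  open import Relation.Binary.PropositionalEquality
  open import Defs using (vecs; comps; perms; IsComp; IsPerm; letters)
  open Indicator
  open Counting
  open ListSum +-*-commutativeSemiring
  open ≡-Reasoning

  δⱽ≢0⇒≡ : ∀ {k} (u v : Vec ℕ k) → ¬ δⱽ u v ≡ 0 → u ≡ v
  δⱽ≢0⇒≡ u v = 𝟙≢0⇒ (Vec.≡-dec _≟_ u v)

  All-vecs : ∀ {A : Set} {Q : A → Set} k {xs : List A} → Allᴸ Q xs → Allᴸ (All Q) (vecs k xs)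
  All-vecs zero    qs = [] ∷ []
  All-vecs (suc k) qs = Allᴸ.concat⁺ (Allᴸ.map⁺ (Allᴸ.map (λ q → Allᴸ.map⁺ (Allᴸ.map (q ∷_) (All-vecs k qs))) qs))

  comps-sound : ∀ k d → Allᴸ (λ J → IsComp J × sum J ≡ d) (comps k d)
  comps-sound k d = Allᴸ.zip (Allᴸ.filter⁺ _ (All-vecs k (Allᴸ.map⁺ (Allᴸ.universal (λ _ → s≤s z≤n) (upTo d)))) ,
                              Allᴸ.all-filter _ (vecs k (map suc (upTo d))))

  ∑-comps-δⱽ : ∀ k d (J : Vec ℕ k) → IsComp J → sum J ≡ d → ∑ (comps k d) (λ J′ → δⱽ J′ J) ≡ 1
  ∑-comps-δⱽ k d J cJ refl = begin
    ∑ (comps k d) (λ J′ → δⱽ J′ J)                      ≡⟨ ∑-filter-implied (λ J′ → sum J′ ≟ d) (vecs k parts) _ (λ J′ ≢0 → cong sum (δⱽ≢0⇒≡ J′ J ≢0)) ⟩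
    ∑ (vecs k parts) (λ J′ → δⱽ J′ J)                   ≡⟨ ∑-cong (vecs k parts) (λ J′ → cong (λ v → δⱽ v J) (Vec.map-id J′)) ⟨
    ∑ (vecs k parts) (λ J′ → δⱽ (Vec.map (λ x → x) J′) J) ≡⟨ ∑-vecs-δⱽ k parts (λ x → x) J (each-part-once J cJ (parts≤sum J)) ⟩
    1                                                   ∎
    where
    parts = map suc (upTo d)
    parts≤sum : ∀ {k} (J′ : Vec ℕ k) → All (_≤ sum J′) J′
    parts≤sum []       = []
    parts≤sum (j ∷ J′) = m≤m+n j (sum J′) ∷ All.map (λ j′≤ → ≤-trans j′≤ (m≤n+m (sum J′) j)) (parts≤sum J′)
    each-part-once : ∀ {k} (J′ : Vec ℕ k) → IsComp J′ → All (_≤ d) J′ → All (λ j → ∑ parts (λ x → δ x j) ≡ 1) J′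
    each-part-once []            []            []          = []
    each-part-once (suc j ∷ J′) (_ ∷ cJ′) (sj≤d ∷ J′≤d) =
      trans (∑-map suc (upTo d) _) (trans (∑-cong (upTo d) (λ y → δ-suc y j)) (∑-upTo-δ-member d j sj≤d))
      ∷ each-part-once J′ cJ′ J′≤d

  map-toℕ-allFin : ∀ N → map toℕ (allFin N) ≡ upTo N
  map-toℕ-allFin N = trans (List.map-tabulate (λ x → x) toℕ) (tabulate-toℕ N (λ x → x))
    where
    tabulate-toℕ : ∀ N (f : ℕ → ℕ) → tabulate (f ∘ toℕ {N}) ≡ applyUpTo f N
    tabulate-toℕ zero    f = refl
    tabulate-toℕ (suc N) f = cong (f 0 ∷_) (tabulate-toℕ N (f ∘ suc))

  letters-injective : ∀ {N k} (σ τ : Vec (Fin N) k) →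
                      Vec.map (suc ∘ toℕ) σ ≡ Vec.map (suc ∘ toℕ) τ → σ ≡ τ
  letters-injective []      []      _ = refl
  letters-injective (x ∷ σ) (y ∷ τ) e =
    cong₂ _∷_ (Fin.toℕ-injective (suc-injective (Vec.∷-injectiveˡ e))) (letters-injective σ τ (Vec.∷-injectiveʳ e))

  ∑-perms-δⱽ : ∀ N (τ : Vec (Fin N) N) → IsPerm τ → ∑ (perms N) (λ σ → δⱽ (letters σ) (letters τ)) ≡ 1
  ∑-perms-δⱽ N τ pτ = begin
    ∑ (perms N) (λ σ → δⱽ (letters σ) (letters τ))
      ≡⟨ ∑-filter-implied _ (vecs N (allFin N)) _ (λ σ ≢0 → subst IsPerm (sym (letters-injective σ τ (δⱽ≢0⇒≡ _ _ ≢0))) pτ) ⟩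
    ∑ (vecs N (allFin N)) (λ σ → δⱽ (letters σ) (letters τ))
      ≡⟨ ∑-vecs-δⱽ N (allFin N) (suc ∘ toℕ) (letters τ) (AllV.map⁺ (All.universal each-letter-once τ)) ⟩
    1 ∎
    where
    each-letter-once : ∀ t → ∑ (allFin N) (λ x → δ (suc (toℕ x)) (suc (toℕ t))) ≡ 1
    each-letter-once t = begin
      ∑ (allFin N) (λ x → δ (suc (toℕ x)) (suc (toℕ t))) ≡⟨ ∑-cong (allFin N) (λ x → δ-suc (toℕ x) (toℕ t)) ⟩
      ∑ (allFin N) (λ x → δ (toℕ x) (toℕ t))             ≡⟨ ∑-map toℕ (allFin N) (λ y → δ y (toℕ t)) ⟨
      ∑ (map toℕ (allFin N)) (λ y → δ y (toℕ t))         ≡⟨ cong (λ l → ∑ l (λ y → δ y (toℕ t))) (map-toℕ-allFin N) ⟩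
      ∑ (upTo N) (λ y → δ y (toℕ t))                     ≡⟨ ∑-upTo-δ-member N (toℕ t) (Fin.toℕ<n t) ⟩
      1                                                  ∎

module Unitriangular where
  open import Data.Nat
  open import Data.Nat.Properties
  open import Data.Nat.Combinatorics using (_C_; nCn≡1; k>n⇒nCk≡0)
  open import Data.Sum using (_⊎_; inj₁; inj₂)
  open import Data.Product using (_×_; _,_)
  open import Data.Vec using (Vec; []; _∷_; sum)
  open import Data.Vec.Relation.Unary.All using ([]; _∷_)
  open import Data.Empty using (⊥-elim)
  open import Relation.Nullary using (¬_; yes; no)
  open import Relation.Binary.PropositionalEquality
  open import Defs using (cAux; IsComp)

  -- Strictly increases from I to J whenever c_IJ ≠ 0 and I ≠ J: this makes (c_IJ) unitriangular.
  potential : ∀ {k} → ℕ → Vec ℕ k → ℕ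
  potential p []      = p
  potential p (x ∷ X) = p + potential (p + x) X

  cAux-diagonal : ∀ {k} p (J : Vec ℕ k) → IsComp J → cAux p p J J ≡ 1
  cAux-diagonal p []      []           = refl
  cAux-diagonal p (j ∷ J) (1≤j ∷ cJ) = trans (cong₂ _*_ Cj≡1 (cAux-diagonal (p + j) J cJ)) refl
    where
    Cj≡1 : ((p + j) ∸ p ∸ 1) C (j ∸ 1) ≡ 1
    Cj≡1 = trans (cong (λ t → (t ∸ 1) C (j ∸ 1)) (m+n∸m≡n p j)) (nCn≡1 (j ∸ 1))

  cAux≢0⇒≡⊎potential< : ∀ {k} (I J : Vec ℕ k) pI pJ → IsComp J → pI ≤ pJ → pI + sum I ≡ pJ + sum J →
                        ¬ cAux pI pJ I J ≡ 0 → (pI ≡ pJ × I ≡ J) ⊎ potential pI I < potential pJ J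
  cAux≢0⇒≡⊎potential< []      []      pI pJ []           pI≤pJ e ≢0 =
    inj₁ (trans (sym (+-identityʳ pI)) (trans e (+-identityʳ pJ)) , refl)
  cAux≢0⇒≡⊎potential< (i ∷ I) (j ∷ J) pI pJ (1≤j ∷ cJ) pI≤pJ e ≢0
    with cAux≢0⇒≡⊎potential< I J (pI + i) (pJ + j) cJ pI+i≤pJ+j e′ rest≢0
    where
    c₀ = ((pJ + j) ∸ pI ∸ 1) C (i ∸ 1)
    c₀≢0 : ¬ c₀ ≡ 0
    c₀≢0 c₀≡0 = ≢0 (cong (_* cAux (pI + i) (pJ + j) I J) c₀≡0)
    rest≢0 : ¬ cAux (pI + i) (pJ + j) I J ≡ 0
    rest≢0 r≡0 = ≢0 (trans (cong (c₀ *_) r≡0) (*-zeroʳ c₀))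
    pI<pJ+j : pI < pJ + j
    pI<pJ+j = ≤-<-trans pI≤pJ (subst (_< pJ + j) (+-identityʳ pJ) (+-monoʳ-< pJ 1≤j))
    pI+i≤pJ+j : pI + i ≤ pJ + j
    pI+i≤pJ+j with i ∸ 1 ≤? (pJ + j) ∸ pI ∸ 1
    ... | no  i≰ = ⊥-elim (c₀≢0 (k>n⇒nCk≡0 (≰⇒> i≰)))
    ... | yes i≤ = block-fits i i≤
      where
      block-fits : ∀ i → i ∸ 1 ≤ (pJ + j) ∸ pI ∸ 1 → pI + i ≤ pJ + j
      block-fits zero     _  = ≤-trans (≤-reflexive (+-identityʳ pI)) (≤-trans pI≤pJ (m≤m+n pJ j))
      block-fits (suc i′) i≤ = subst (_≤ pJ + j) (sym (+-suc pI i′))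
        (subst (suc (pI + i′) ≤_) (m+[n∸m]≡n pI<pJ+j) (+-monoʳ-≤ (suc pI)
          (subst (i′ ≤_) (trans (∸-+-assoc (pJ + j) pI 1) (cong ((pJ + j) ∸_) (+-comm pI 1))) i≤)))
    e′ : pI + i + sum I ≡ pJ + j + sum J
    e′ = trans (+-assoc pI i (sum I)) (trans e (sym (+-assoc pJ j (sum J))))
  ... | inj₁ (pI+i≡pJ+j , refl) with pI ≟ pJ
  ...   | yes refl = inj₁ (refl , cong (_∷ I) (+-cancelˡ-≡ pI i j pI+i≡pJ+j))
  ...   | no  pI≢pJ = inj₂ (subst (λ t → pI + potential (pI + i) I < pJ + potential t I) pI+i≡pJ+j
                                (+-monoˡ-< (potential (pI + i) I) (≤∧≢⇒< pI≤pJ pI≢pJ)))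
  cAux≢0⇒≡⊎potential< (i ∷ I) (j ∷ J) pI pJ (1≤j ∷ cJ) pI≤pJ e ≢0 | inj₂ lt = inj₂ (+-mono-≤-< pI≤pJ lt)

  potential≤ : ∀ {k} p (X : Vec ℕ k) → potential p X ≤ suc k * (p + sum X)
  potential≤ {zero}  p []      = ≤-trans (≤-reflexive (sym (+-identityʳ p))) (m≤m+n (p + 0) _)
  potential≤ {suc k} p (x ∷ X) = begin
    p + potential (p + x) X          ≤⟨ +-monoʳ-≤ p (potential≤ (p + x) X) ⟩
    p + suc k * (p + x + sum X)      ≡⟨ cong (λ t → p + suc k * t) (+-assoc p x (sum X)) ⟩
    p + suc k * (p + (x + sum X))    ≤⟨ +-monoˡ-≤ (suc k * (p + (x + sum X))) (m≤m+n p (x + sum X)) ⟩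
    suc (suc k) * (p + (x + sum X))  ∎
    where open ≤-Reasoning

module Decode where
  open import Data.Nat
  open import Data.Nat.Properties
  import Data.Nat.ListAction as ListAction
  import Data.Nat.ListAction.Properties as ListAction
  open import Data.Fin as Fin using (Fin; toℕ; fromℕ<)
  import Data.Fin.Properties as Fin
  open import Data.Product using (Σ; _×_; _,_; proj₁; proj₂)
  open import Data.List using (List; []; _∷_; _++_; map; length)
  import Data.List.Properties as List
  open import Data.List.Relation.Unary.All as Allᴸ using ([]; _∷_) renaming (All to Allᴸ)
  import Data.List.Relation.Unary.All.Properties as Allᴸ
  open import Data.List.Relation.Unary.Unique.Propositional using (Unique)
  import Data.List.Relation.Unary.Unique.Propositional.Properties as Unique
  open import Data.List.Relation.Binary.Permutation.Propositional using (_↭_; ↭-refl; ↭-sym; ↭-trans; ↭-reflexive; prep; ↭⇒↭ₛ)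
  import Data.List.Relation.Binary.Permutation.Propositional.Properties as ↭
  import Data.List.Relation.Binary.Permutation.Setoid.Properties as ↭ₛ
  open import Data.Vec using (Vec; []; _∷_; toList; sum)
  import Data.Vec as Vec
  import Data.Vec.Properties as Vec
  open import Data.Vec.Relation.Unary.All using ([]; _∷_)
  open import Function using (_∘_)
  open import Relation.Binary.PropositionalEquality
  open import Defs using (ColWord; shuffles; IsPerm; IsComp; letters; shiftLetters)
  open Parse using (colored; weight; PositiveColors; colored-positive; weight-colored)

  private variable
    A : Set

  shuffles-↭ : (xs ys : List A) → Allᴸ (_↭ xs ++ ys) (shuffles xs ys)
  shuffles-↭ []       ys       = ↭-refl ∷ []
  shuffles-↭ (x ∷ xs) []       = ↭-reflexive (sym (List.++-identityʳ (x ∷ xs))) ∷ []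
  shuffles-↭ (x ∷ xs) (y ∷ ys) = Allᴸ.++⁺
    (Allᴸ.map⁺ (Allᴸ.map (prep x) (shuffles-↭ xs (y ∷ ys))))
    (Allᴸ.map⁺ (Allᴸ.map (λ p → ↭-trans (prep y p) (↭-sym (↭.shift y (x ∷ xs) ys))) (shuffles-↭ (x ∷ xs) ys)))

  Unique-resp-↭ : {xs ys : List A} → xs ↭ ys → Unique xs → Unique ys
  Unique-resp-↭ p = ↭ₛ.Unique-resp-↭ (setoid _) (↭⇒↭ₛ p)

  map-proj₁-colored : ∀ {k} (ls I : Vec ℕ k) → map proj₁ (colored ls I) ≡ toList ls
  map-proj₁-colored []       []      = refl
  map-proj₁-colored (l ∷ ls) (i ∷ I) = cong (l ∷_) (map-proj₁-colored ls I)

  length-colored : ∀ {k} (ls I : Vec ℕ k) → length (colored ls I) ≡ k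
  length-colored []       []      = refl
  length-colored (l ∷ ls) (i ∷ I) = cong suc (length-colored ls I)

  decode : ∀ N k (u : ColWord) → length u ≡ k → Allᴸ (λ a → 1 ≤ a × a ≤ N) (map proj₁ u) →
           Σ (Vec (Fin N) k) λ τ → Σ (Vec ℕ k) λ I → colored (Vec.map (suc ∘ toℕ) τ) I ≡ u
  decode N zero    []                  refl []                 = [] , [] , refl
  decode N (suc k) ((suc a , i) ∷ u) refl ((_ , a<N) ∷ range) with decode N k u refl range
  ... | τ , I , eq = fromℕ< a<N ∷ τ , i ∷ I , cong₂ _∷_ (cong (λ t → suc t , i) (Fin.toℕ-fromℕ< a<N)) eq

  positive⇒IsComp : ∀ {k} (ls I : Vec ℕ k) → PositiveColors (colored ls I) → IsComp I
  positive⇒IsComp []       []      []          = []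
  positive⇒IsComp (l ∷ ls) (i ∷ I) (1≤i ∷ pos) = 1≤i ∷ positive⇒IsComp ls I pos

  ColoredPermutation : ℕ → ℕ → ColWord → Set
  ColoredPermutation N d u =
    Σ (Vec (Fin N) N) λ τ → Σ (Vec ℕ N) λ I → colored (letters τ) I ≡ u × IsPerm τ × IsComp I × sum I ≡ d

  -- The hypotheses are invariant under rearranging u, so they pass from u₁ ++ u₂ to its shuffles.
  coloredPermutation : ∀ N d (u : ColWord) → length u ≡ N → Allᴸ (λ a → 1 ≤ a × a ≤ N) (map proj₁ u) →
                       Unique (map proj₁ u) → PositiveColors u → weight u ≡ d → ColoredPermutation N d u
  coloredPermutation N d u |u|≡N range unique pos weight≡d with decode N N u |u|≡N range
  ... | τ , I , refl = τ , I , refl , IsPerm-τ , positive⇒IsComp (letters τ) I pos ,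
                       trans (sym (weight-colored (letters τ) I)) weight≡d
    where
    IsPerm-τ : IsPerm τ
    IsPerm-τ = Unique.map⁻ (subst Unique (trans (map-proj₁-colored (letters τ) I) (Vec.toList-map (suc ∘ toℕ) τ)) unique)

  shuffle-coloredPermutation : ∀ n m (σ′ : Vec (Fin n) n) (σ″ : Vec (Fin m) m) (I₁ : Vec ℕ n) (I₂ : Vec ℕ m) →
    IsPerm σ′ → IsPerm σ″ → IsComp I₁ → IsComp I₂ →
    Allᴸ (ColoredPermutation (n + m) (sum I₁ + sum I₂))
         (shuffles (colored (letters σ′) I₁) (colored (shiftLetters n (letters σ″)) I₂))
  shuffle-coloredPermutation n m σ′ σ″ I₁ I₂ pσ′ pσ″ cI₁ cI₂ = Allᴸ.map rearranged (shuffles-↭ u₁ u₂)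
    where
    ls₁ = letters σ′
    ls₂ = shiftLetters n (letters σ″)
    u₁ = colored ls₁ I₁
    u₂ = colored ls₂ I₂
    g₂ : Fin m → ℕ
    g₂ x = suc (toℕ x) + n
    letters₁ : map proj₁ u₁ ≡ map (suc ∘ toℕ) (toList σ′)
    letters₁ = trans (map-proj₁-colored ls₁ I₁) (Vec.toList-map (suc ∘ toℕ) σ′)
    letters₂ : map proj₁ u₂ ≡ map g₂ (toList σ″)
    letters₂ = trans (map-proj₁-colored ls₂ I₂) (trans (cong toList (sym (Vec.map-∘ (_+ n) (suc ∘ toℕ) σ″))) (Vec.toList-map g₂ σ″))
    low : Allᴸ (λ a → (1 ≤ a × a ≤ n + m) × a ≤ n) (map proj₁ u₁)
    low = subst (Allᴸ _) (sym letters₁) (Allᴸ.map⁺ (Allᴸ.universal (λ x → (s≤s z≤n , ≤-trans (Fin.toℕ<n x) (m≤m+n n m)) , Fin.toℕ<n x) _))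
    high : Allᴸ (λ a → (1 ≤ a × a ≤ n + m) × n < a) (map proj₁ u₂)
    high = subst (Allᴸ _) (sym letters₂) (Allᴸ.map⁺ (Allᴸ.universal (λ x →
      (s≤s z≤n , ≤-trans (+-monoˡ-≤ n (Fin.toℕ<n x)) (≤-reflexive (+-comm m n))) , m<n+m n (s≤s z≤n)) _))
    unique : Unique (map proj₁ (u₁ ++ u₂))
    unique = subst Unique (sym (List.map-++ proj₁ u₁ u₂)) (Unique.++⁺
      (subst Unique (sym letters₁) (Unique.map⁺ (Fin.toℕ-injective ∘ suc-injective) pσ′))
      (subst Unique (sym letters₂) (Unique.map⁺ (Fin.toℕ-injective ∘ suc-injective ∘ +-cancelʳ-≡ n _ _) pσ″))
      (λ (a∈₁ , a∈₂) → <⇒≱ (proj₂ (Allᴸ.lookup high a∈₂)) (proj₂ (Allᴸ.lookup low a∈₁))))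
    rearranged : ∀ {u} → u ↭ u₁ ++ u₂ → ColoredPermutation (n + m) (sum I₁ + sum I₂) u
    rearranged {u} p = coloredPermutation (n + m) _ u
      (trans (↭.↭-length p) (trans (List.length-++ u₁) (cong₂ _+_ (length-colored ls₁ I₁) (length-colored ls₂ I₂))))
      (↭.All-resp-↭ (↭-sym (↭.map⁺ proj₁ p))
        (subst (Allᴸ _) (sym (List.map-++ proj₁ u₁ u₂)) (Allᴸ.++⁺ (Allᴸ.map proj₁ low) (Allᴸ.map proj₁ high))))
      (Unique-resp-↭ (↭-sym (↭.map⁺ proj₁ p)) unique)
      (↭.All-resp-↭ (↭-sym p) (Allᴸ.++⁺ (colored-positive ls₁ I₁ cI₁) (colored-positive ls₂ I₂ cI₂)))
      (trans (ListAction.sum-↭ (↭.map⁺ proj₂ p))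
        (trans (cong ListAction.sum (List.map-++ proj₂ u₁ u₂))
          (trans (ListAction.sum-++ (map proj₂ u₁) _) (cong₂ _+_ (weight-colored ls₁ I₁) (weight-colored ls₂ I₂)))))

module Coefficients {c ℓ} (R : CommutativeRing c ℓ) where
  open import Data.Nat as ℕ using (ℕ; zero; suc)
  import Data.Nat.Properties as ℕ
  open import Data.Bool using (if_then_else_)
  open import Data.Product using (_,_)
  open import Data.List using (List; []; _∷_; map; concatMap; length)
  open import Data.Empty using (⊥-elim)
  open import Relation.Nullary using (¬_; yes; no; does)
  import Relation.Binary.PropositionalEquality as P
  open import Defs using (ColWord; shuffles; module FQSymN)

  open CommutativeRing R
  open FQSymN R
  open ListSum commutativeSemiring
  module ℕΣ = ListSum ℕ.+-*-commutativeSemiring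
  open import Relation.Binary.Reasoning.Setoid setoid
  open import Algebra.Properties.Semiring.Mult semiring using (_×_; ×-homo-+; ×1-homo-*)
  open import Algebra.Properties.CommutativeSemigroup *-commutativeSemigroup using (x∙yz≈y∙xz)
  open import Algebra.Properties.CommutativeSemigroup +-commutativeSemigroup using () renaming (x∙yz≈y∙xz to +-x∙yz≈y∙xz)

  fromℕ≈×1# : ∀ n → fromℕ n ≈ n × 1#
  fromℕ≈×1# zero    = refl
  fromℕ≈×1# (suc n) = +-cong refl (fromℕ≈×1# n)

  fromℕ-+ : ∀ m n → fromℕ (m ℕ.+ n) ≈ fromℕ m + fromℕ n
  fromℕ-+ m n = trans (fromℕ≈×1# (m ℕ.+ n)) (trans (×-homo-+ 1# m n) (sym (+-cong (fromℕ≈×1# m) (fromℕ≈×1# n))))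

  fromℕ-* : ∀ m n → fromℕ (m ℕ.* n) ≈ fromℕ m * fromℕ n
  fromℕ-* m n = trans (fromℕ≈×1# (m ℕ.* n)) (trans (×1-homo-* m n) (sym (*-cong (fromℕ≈×1# m) (fromℕ≈×1# n))))

  fromℕ-∑ : {A : Set} (xs : List A) (F : A → ℕ) → fromℕ (ℕΣ.∑ xs F) ≈ ∑ xs (λ x → fromℕ (F x))
  fromℕ-∑ []       F = refl
  fromℕ-∑ (x ∷ xs) F = trans (fromℕ-+ (F x) _) (+-cong refl (fromℕ-∑ xs F))

  fromℕ-1 : fromℕ 1 ≈ 1#
  fromℕ-1 = +-identityʳ 1#

  ∑-select : {A : Set} (xs : List A) (D : A → ℕ) (h : A → Carrier) (v : A) → (∀ x → ¬ D x P.≡ 0 → h x ≈ h v) →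
             ∑ xs (λ x → fromℕ (D x) * h x) ≈ fromℕ (ℕΣ.∑ xs D) * h v
  ∑-select xs D h v h≈hv = begin
    ∑ xs (λ x → fromℕ (D x) * h x)   ≈⟨ ∑-cong xs term ⟩
    ∑ xs (λ x → fromℕ (D x) * h v)   ≈⟨ *-distribʳ-∑ xs (h v) _ ⟨
    ∑ xs (λ x → fromℕ (D x)) * h v   ≈⟨ *-cong (fromℕ-∑ xs D) refl ⟨
    fromℕ (ℕΣ.∑ xs D) * h v          ∎
    where
    term : ∀ x → fromℕ (D x) * h x ≈ fromℕ (D x) * h v
    term x with D x ℕ.≟ 0
    ... | yes D≡0 = trans (*-cong (reflexive (P.cong fromℕ D≡0)) refl)
                    (trans (zeroˡ _) (sym (trans (*-cong (reflexive (P.cong fromℕ D≡0)) refl) (zeroˡ _))))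
    ... | no  D≢0 = *-cong refl (h≈hv x D≢0)

  δᴿ : ColWord → ColWord → Carrier
  δᴿ u w = if does (colWordDec u w) then 1# else 0#

  ⟪_∣_⟫ : (ColWord → Carrier) → Elem → Carrier
  ⟪ G ∣ x ⟫ = ∑ x (λ (a , u) → a * G u)

  coeff≈⟪δᴿ⟫ : ∀ x w → coeff x w ≈ ⟪ (λ u → δᴿ u w) ∣ x ⟫
  coeff≈⟪δᴿ⟫ []             w = refl
  coeff≈⟪δᴿ⟫ ((a , u) ∷ xs) w with colWordDec u w
  ... | yes _ = +-cong (sym (*-identityʳ a)) (coeff≈⟪δᴿ⟫ xs w)
  ... | no  _ = trans (coeff≈⟪δᴿ⟫ xs w) (trans (sym (+-identityˡ _)) (+-cong (sym (zeroʳ a)) refl))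

  ⟪⟫-congˡ : ∀ {G G′} x → (∀ u → G u ≈ G′ u) → ⟪ G ∣ x ⟫ ≈ ⟪ G′ ∣ x ⟫
  ⟪⟫-congˡ x G≈G′ = ∑-cong x (λ (a , u) → *-cong refl (G≈G′ u))

  ⟪⟫-Σ-list : ∀ G {A : Set} (xs : List A) (f : A → Elem) → ⟪ G ∣ Σ-list xs f ⟫ ≈ ∑ xs (λ a → ⟪ G ∣ f a ⟫)
  ⟪⟫-Σ-list G xs f = ∑-concatMap f xs _

  ⟪⟫-scale : ∀ G a x → ⟪ G ∣ scale a x ⟫ ≈ a * ⟪ G ∣ x ⟫
  ⟪⟫-scale G a x = begin
    ∑ (scale a x) (λ (b , u) → b * G u)  ≈⟨ ∑-map _ x _ ⟩
    ∑ x (λ (b , u) → (a * b) * G u)      ≈⟨ ∑-cong x (λ (b , u) → *-assoc a b (G u)) ⟩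
    ∑ x (λ (b , u) → a * (b * G u))      ≈⟨ *-distribˡ-∑ x a _ ⟨
    a * ⟪ G ∣ x ⟫                        ∎

  ⟪⟫-∑ : ∀ {A : Set} (ys : List A) (d : A → Carrier) (H : A → ColWord → Carrier) x →
         ⟪ (λ u → ∑ ys (λ b → d b * H b u)) ∣ x ⟫ ≈ ∑ ys (λ b → d b * ⟪ H b ∣ x ⟫)
  ⟪⟫-∑ ys d H x = begin
    ∑ x (λ (a , u) → a * ∑ ys (λ b → d b * H b u))   ≈⟨ ∑-cong x (λ (a , u) → *-distribˡ-∑ ys a _) ⟩
    ∑ x (λ (a , u) → ∑ ys (λ b → a * (d b * H b u))) ≈⟨ ∑-comm x ys _ ⟩
    ∑ ys (λ b → ∑ x (λ (a , u) → a * (d b * H b u))) ≈⟨ ∑-cong ys (λ b → ∑-cong x (λ (a , u) → x∙yz≈y∙xz a (d b) (H b u))) ⟩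
    ∑ ys (λ b → ∑ x (λ (a , u) → d b * (a * H b u))) ≈⟨ ∑-cong ys (λ b → *-distribˡ-∑ x (d b) _) ⟨
    ∑ ys (λ b → d b * ⟪ H b ∣ x ⟫)                   ∎

  -- ⟪ G ∣ x ⟫ depends only on the coefficients of x: remove the terms with word u one at a time.
  module _ (G : ColWord → Carrier) where

    without : ColWord → Elem → Elem
    without u []            = []
    without u ((a , v) ∷ x) with colWordDec v u
    ... | yes _ = without u x
    ... | no  _ = (a , v) ∷ without u x

    ⟪⟫-without : ∀ u x → ⟪ G ∣ x ⟫ ≈ coeff x u * G u + ⟪ G ∣ without u x ⟫
    ⟪⟫-without u []            = sym (trans (+-identityʳ _) (zeroˡ _))
    ⟪⟫-without u ((a , v) ∷ x) with colWordDec v u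
    ... | yes P.refl = begin
      a * G v + ⟪ G ∣ x ⟫                                   ≈⟨ +-cong refl (⟪⟫-without v x) ⟩
      a * G v + (coeff x v * G v + ⟪ G ∣ without v x ⟫)     ≈⟨ +-assoc _ _ _ ⟨
      (a * G v + coeff x v * G v) + ⟪ G ∣ without v x ⟫     ≈⟨ +-cong (distribʳ _ _ _) refl ⟨
      (a + coeff x v) * G v + ⟪ G ∣ without v x ⟫           ∎
    ... | no  _ = begin
      a * G v + ⟪ G ∣ x ⟫                                   ≈⟨ +-cong refl (⟪⟫-without u x) ⟩
      a * G v + (coeff x u * G u + ⟪ G ∣ without u x ⟫)     ≈⟨ +-x∙yz≈y∙xz _ _ _ ⟩
      coeff x u * G u + (a * G v + ⟪ G ∣ without u x ⟫)     ∎

    coeff-without-≡ : ∀ u x → coeff (without u x) u ≈ 0#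
    coeff-without-≡ u []            = refl
    coeff-without-≡ u ((a , v) ∷ x) with colWordDec v u
    ... | yes _ = coeff-without-≡ u x
    ... | no v≢u with colWordDec v u
    ...   | yes v≡u = ⊥-elim (v≢u v≡u)
    ...   | no  _   = coeff-without-≡ u x

    coeff-without-≢ : ∀ u w x → ¬ w P.≡ u → coeff (without u x) w ≈ coeff x w
    coeff-without-≢ u w []            _   = refl
    coeff-without-≢ u w ((a , v) ∷ x) w≢u with colWordDec v u
    ... | yes P.refl with colWordDec v w
    ...   | yes v≡w = ⊥-elim (w≢u (P.sym v≡w))
    ...   | no  _   = coeff-without-≢ u w x w≢u
    coeff-without-≢ u w ((a , v) ∷ x) w≢u | no _ with colWordDec v w
    ...   | yes _ = +-cong refl (coeff-without-≢ u w x w≢u)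
    ...   | no  _ = coeff-without-≢ u w x w≢u

    without-≋ : ∀ u {x x′} → x ≋ x′ → without u x ≋ without u x′
    without-≋ u {x} {x′} x≋x′ w with colWordDec w u
    ... | yes P.refl = trans (coeff-without-≡ u x) (sym (coeff-without-≡ u x′))
    ... | no  w≢u    = trans (coeff-without-≢ u w x w≢u) (trans (x≋x′ w) (sym (coeff-without-≢ u w x′ w≢u)))

    length-without : ∀ u x → length (without u x) ℕ.≤ length x
    length-without u []            = ℕ.z≤n
    length-without u ((a , v) ∷ x) with colWordDec v u
    ... | yes _ = ℕ.m≤n⇒m≤1+n (length-without u x)
    ... | no  _ = ℕ.s≤s (length-without u x)

    length-without-head : ∀ a u x → length (without u ((a , u) ∷ x)) ℕ.≤ length x
    length-without-head a u x with colWordDec u u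
    ... | yes _  = length-without u x
    ... | no u≢u = ⊥-elim (u≢u P.refl)

    ⟪⟫≈0 : ∀ n x → length x ℕ.≤ n → x ≋ [] → ⟪ G ∣ x ⟫ ≈ 0#
    ⟪⟫≈0 n       []            _              _    = refl
    ⟪⟫≈0 (suc n) ((a , u) ∷ x) (ℕ.s≤s |x|≤n) x≋[] = begin
      ⟪ G ∣ (a , u) ∷ x ⟫                                     ≈⟨ ⟪⟫-without u ((a , u) ∷ x) ⟩
      coeff ((a , u) ∷ x) u * G u + ⟪ G ∣ without u ((a , u) ∷ x) ⟫
        ≈⟨ +-cong (*-cong (x≋[] u) refl)
                  (⟪⟫≈0 n (without u ((a , u) ∷ x)) (ℕ.≤-trans (length-without-head a u x) |x|≤n)
                        (without-≋ u {(a , u) ∷ x} {[]} x≋[])) ⟩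
      0# * G u + 0#                                           ≈⟨ trans (+-identityʳ _) (zeroˡ _) ⟩
      0#                                                      ∎

    ⟪⟫-cong-bounded : ∀ n x x′ → length x ℕ.≤ n → x ≋ x′ → ⟪ G ∣ x ⟫ ≈ ⟪ G ∣ x′ ⟫
    ⟪⟫-cong-bounded n       []            x′ _ x≋x′ = sym (⟪⟫≈0 (length x′) x′ ℕ.≤-refl (λ w → sym (x≋x′ w)))
    ⟪⟫-cong-bounded (suc n) ((a , u) ∷ x) x′ (ℕ.s≤s |x|≤n) x≋x′ = begin
      ⟪ G ∣ (a , u) ∷ x ⟫                                     ≈⟨ ⟪⟫-without u ((a , u) ∷ x) ⟩
      coeff ((a , u) ∷ x) u * G u + ⟪ G ∣ without u ((a , u) ∷ x) ⟫
        ≈⟨ +-cong (*-cong (x≋x′ u) refl)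
                  (⟪⟫-cong-bounded n (without u ((a , u) ∷ x)) (without u x′) (ℕ.≤-trans (length-without-head a u x) |x|≤n)
                                    (without-≋ u {(a , u) ∷ x} {x′} x≋x′)) ⟩
      coeff x′ u * G u + ⟪ G ∣ without u x′ ⟫                ≈⟨ ⟪⟫-without u x′ ⟨
      ⟪ G ∣ x′ ⟫                                              ∎

    ⟪⟫-cong : ∀ x x′ → x ≋ x′ → ⟪ G ∣ x ⟫ ≈ ⟪ G ∣ x′ ⟫
    ⟪⟫-cong x x′ = ⟪⟫-cong-bounded (length x) x x′ ℕ.≤-refl

  coeff-Σ-list : ∀ {A : Set} (xs : List A) (f : A → Elem) w → coeff (Σ-list xs f) w ≈ ∑ xs (λ a → coeff (f a) w)
  coeff-Σ-list xs f w = begin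
    coeff (Σ-list xs f) w                        ≈⟨ coeff≈⟪δᴿ⟫ (Σ-list xs f) w ⟩
    ⟪ (λ u → δᴿ u w) ∣ Σ-list xs f ⟫             ≈⟨ ⟪⟫-Σ-list _ xs f ⟩
    ∑ xs (λ a → ⟪ (λ u → δᴿ u w) ∣ f a ⟫)        ≈⟨ ∑-cong xs (λ a → coeff≈⟪δᴿ⟫ (f a) w) ⟨
    ∑ xs (λ a → coeff (f a) w)                   ∎

  coeff-scale : ∀ a x w → coeff (scale a x) w ≈ a * coeff x w
  coeff-scale a x w = begin
    coeff (scale a x) w                 ≈⟨ coeff≈⟪δᴿ⟫ (scale a x) w ⟩
    ⟪ (λ u → δᴿ u w) ∣ scale a x ⟫      ≈⟨ ⟪⟫-scale _ a x ⟩
    a * ⟪ (λ u → δᴿ u w) ∣ x ⟫          ≈⟨ *-cong refl (coeff≈⟪δᴿ⟫ x w) ⟨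
    a * coeff x w                       ∎

  shuffleCount : ColWord → ColWord → ColWord → Carrier
  shuffleCount w u v = ∑ (shuffles u (shiftCol (length u) v)) (λ w′ → δᴿ w′ w)

  coeff-⋆ : ∀ x y w → coeff (x ⋆ y) w ≈ ⟪ (λ u → ⟪ shuffleCount w u ∣ y ⟫) ∣ x ⟫
  coeff-⋆ x y w = begin
    coeff (x ⋆ y) w
      ≈⟨ coeff≈⟪δᴿ⟫ (x ⋆ y) w ⟩
    ⟪ (λ u → δᴿ u w) ∣ x ⋆ y ⟫
      ≈⟨ ∑-concatMap _ x _ ⟩
    ∑ x (λ (a , u) → ∑ (concatMap (λ (b , v) → map (λ w′ → (a * b , w′)) (S u v)) y) (λ (c , w′) → c * δᴿ w′ w))
      ≈⟨ ∑-cong x (λ (a , u) → ∑-concatMap _ y _) ⟩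
    ∑ x (λ (a , u) → ∑ y (λ (b , v) → ∑ (map (λ w′ → (a * b , w′)) (S u v)) (λ (c , w′) → c * δᴿ w′ w)))
      ≈⟨ ∑-cong x (λ (a , u) → ∑-cong y (λ (b , v) → trans (∑-map _ (S u v) _) (sym (*-distribˡ-∑ (S u v) (a * b) _)))) ⟩
    ∑ x (λ (a , u) → ∑ y (λ (b , v) → (a * b) * shuffleCount w u v))
      ≈⟨ ∑-cong x (λ (a , u) → trans (∑-cong y (λ (b , v) → *-assoc a b _)) (sym (*-distribˡ-∑ y a _))) ⟩
    ⟪ (λ u → ⟪ shuffleCount w u ∣ y ⟫) ∣ x ⟫ ∎
    where
    S : ColWord → ColWord → List ColWord
    S u v = shuffles u (shiftCol (length u) v)

  ⋆-cong : ∀ {x x′ y y′} → x ≋ x′ → y ≋ y′ → (x ⋆ y) ≋ (x′ ⋆ y′)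
  ⋆-cong {x} {x′} {y} {y′} x≋x′ y≋y′ w = begin
    coeff (x ⋆ y) w                              ≈⟨ coeff-⋆ x y w ⟩
    ⟪ (λ u → ⟪ shuffleCount w u ∣ y ⟫) ∣ x ⟫     ≈⟨ ⟪⟫-congˡ x (λ u → ⟪⟫-cong (shuffleCount w u) y y′ y≋y′) ⟩
    ⟪ (λ u → ⟪ shuffleCount w u ∣ y′ ⟫) ∣ x ⟫    ≈⟨ ⟪⟫-cong _ x x′ x≋x′ ⟩
    ⟪ (λ u → ⟪ shuffleCount w u ∣ y′ ⟫) ∣ x′ ⟫   ≈⟨ coeff-⋆ x′ y′ w ⟨
    coeff (x′ ⋆ y′) w                            ∎

  coeff-Σ⋆ : ∀ {A : Set} (xs : List A) (c : A → Carrier) (X : A → Elem) y w →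
             coeff (Σ-list xs (λ a → scale (c a) (X a)) ⋆ y) w ≈ ∑ xs (λ a → c a * coeff (X a ⋆ y) w)
  coeff-Σ⋆ xs c X y w = begin
    coeff (Σ-list xs (λ a → scale (c a) (X a)) ⋆ y) w                   ≈⟨ coeff-⋆ (Σ-list xs (λ a → scale (c a) (X a))) y w ⟩
    ⟪ G ∣ Σ-list xs (λ a → scale (c a) (X a)) ⟫                         ≈⟨ ⟪⟫-Σ-list G xs _ ⟩
    ∑ xs (λ a → ⟪ G ∣ scale (c a) (X a) ⟫)                              ≈⟨ ∑-cong xs (λ a → ⟪⟫-scale G (c a) (X a)) ⟩
    ∑ xs (λ a → c a * ⟪ G ∣ X a ⟫)                                      ≈⟨ ∑-cong xs (λ a → *-cong refl (coeff-⋆ (X a) y w)) ⟨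
    ∑ xs (λ a → c a * coeff (X a ⋆ y) w)                                ∎
    where G = λ u → ⟪ shuffleCount w u ∣ y ⟫

  coeff-⋆Σ : ∀ {A : Set} x (ys : List A) (d : A → Carrier) (Y : A → Elem) w →
             coeff (x ⋆ Σ-list ys (λ b → scale (d b) (Y b))) w ≈ ∑ ys (λ b → d b * coeff (x ⋆ Y b) w)
  coeff-⋆Σ x ys d Y w = begin
    coeff (x ⋆ Σ-list ys (λ b → scale (d b) (Y b))) w
      ≈⟨ coeff-⋆ x (Σ-list ys (λ b → scale (d b) (Y b))) w ⟩
    ⟪ (λ u → ⟪ shuffleCount w u ∣ Σ-list ys (λ b → scale (d b) (Y b)) ⟫) ∣ x ⟫
      ≈⟨ ⟪⟫-congˡ x (λ u → trans (⟪⟫-Σ-list _ ys _) (∑-cong ys (λ b → ⟪⟫-scale _ (d b) (Y b)))) ⟩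
    ⟪ (λ u → ∑ ys (λ b → d b * ⟪ shuffleCount w u ∣ Y b ⟫)) ∣ x ⟫
      ≈⟨ ⟪⟫-∑ ys d (λ b u → ⟪ shuffleCount w u ∣ Y b ⟫) x ⟩
    ∑ ys (λ b → d b * ⟪ (λ u → ⟪ shuffleCount w u ∣ Y b ⟫) ∣ x ⟫)
      ≈⟨ ∑-cong ys (λ b → *-cong refl (coeff-⋆ x (Y b) w)) ⟨
    ∑ ys (λ b → d b * coeff (x ⋆ Y b) w) ∎

  coeff-single⋆single : ∀ u v w → coeff (((1# , u) ∷ []) ⋆ ((1# , v) ∷ [])) w ≈ shuffleCount w u v
  coeff-single⋆single u v w =
    trans (coeff-⋆ ((1# , u) ∷ []) ((1# , v) ∷ []) w) (trans (+-identityʳ _) (trans (*-identityˡ _) (trans (+-identityʳ _) (*-identityˡ _))))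

  ∑-comm₂ : ∀ {A B C : Set} (xs : List A) (ys : List B) (zs : List C) (f : A → B → C → Carrier) →
            ∑ xs (λ x → ∑ ys (λ y → ∑ zs (f x y))) ≈ ∑ zs (λ z → ∑ xs (λ x → ∑ ys (λ y → f x y z)))
  ∑-comm₂ xs ys zs f = trans (∑-cong xs (λ x → ∑-comm ys zs (f x))) (∑-comm xs zs _)

  *-distribˡ-∑₂ : ∀ {A B : Set} (xs : List A) (ys : List B) (a : Carrier) (f : A → B → Carrier) →
                  a * ∑ xs (λ x → ∑ ys (f x)) ≈ ∑ xs (λ x → ∑ ys (λ y → a * f x y))
  *-distribˡ-∑₂ xs ys a f = trans (*-distribˡ-∑ xs a _) (∑-cong xs (λ x → *-distribˡ-∑ ys a (f x)))

  fromℕ-∑∑-reorder : ∀ {X Y A B : Set} (P₁ : List X) (P₂ : List Y) (Q₁ : List A) (Q₂ : List B)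
    (a : A → ℕ) (b : B → ℕ) (o : X → Y → A → B → ℕ) (z : X → Y → Carrier) →
    ∑ P₁ (λ σ → ∑ P₂ (λ J → fromℕ (ℕΣ.∑ Q₁ (λ α → ℕΣ.∑ Q₂ (λ β → a α ℕ.* b β ℕ.* o σ J α β))) * z σ J))
    ≈ ∑ Q₁ (λ α → fromℕ (a α) * ∑ Q₂ (λ β → fromℕ (b β) * ∑ P₁ (λ σ → ∑ P₂ (λ J → fromℕ (o σ J α β) * z σ J))))
  fromℕ-∑∑-reorder P₁ P₂ Q₁ Q₂ a b o z = begin
    ∑ P₁ (λ σ → ∑ P₂ (λ J → fromℕ (ℕΣ.∑ Q₁ (λ α → ℕΣ.∑ Q₂ (λ β → a α ℕ.* b β ℕ.* o σ J α β))) * z σ J))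
      ≈⟨ ∑-cong P₁ (λ σ → ∑-cong P₂ (λ J → expand σ J)) ⟩
    ∑ P₁ (λ σ → ∑ P₂ (λ J → ∑ Q₁ (λ α → ∑ Q₂ (λ β → t σ J α β))))
      ≈⟨ ∑-comm₂ P₁ P₂ Q₁ _ ⟩
    ∑ Q₁ (λ α → ∑ P₁ (λ σ → ∑ P₂ (λ J → ∑ Q₂ (λ β → t σ J α β))))
      ≈⟨ ∑-cong Q₁ (λ α → ∑-comm₂ P₁ P₂ Q₂ _) ⟩
    ∑ Q₁ (λ α → ∑ Q₂ (λ β → ∑ P₁ (λ σ → ∑ P₂ (λ J → t σ J α β))))
      ≈⟨ ∑-cong Q₁ (λ α → trans (∑-cong Q₂ (λ β → sym (*-distribˡ-∑₂ P₁ P₂ (fromℕ (a α)) _))) (sym (*-distribˡ-∑ Q₂ (fromℕ (a α)) _))) ⟩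
    ∑ Q₁ (λ α → fromℕ (a α) * ∑ Q₂ (λ β → ∑ P₁ (λ σ → ∑ P₂ (λ J → fromℕ (b β) * (fromℕ (o σ J α β) * z σ J)))))
      ≈⟨ ∑-cong Q₁ (λ α → *-cong refl (∑-cong Q₂ (λ β → sym (*-distribˡ-∑₂ P₁ P₂ (fromℕ (b β)) _)))) ⟩
    ∑ Q₁ (λ α → fromℕ (a α) * ∑ Q₂ (λ β → fromℕ (b β) * ∑ P₁ (λ σ → ∑ P₂ (λ J → fromℕ (o σ J α β) * z σ J)))) ∎
    where
    t = λ σ J α β → fromℕ (a α) * (fromℕ (b β) * (fromℕ (o σ J α β) * z σ J))
    expand : ∀ σ J → fromℕ (ℕΣ.∑ Q₁ (λ α → ℕΣ.∑ Q₂ (λ β → a α ℕ.* b β ℕ.* o σ J α β))) * z σ J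
                     ≈ ∑ Q₁ (λ α → ∑ Q₂ (λ β → t σ J α β))
    expand σ J = begin
      fromℕ (ℕΣ.∑ Q₁ (λ α → ℕΣ.∑ Q₂ (λ β → a α ℕ.* b β ℕ.* o σ J α β))) * z σ J
        ≈⟨ *-cong (trans (fromℕ-∑ Q₁ _) (∑-cong Q₁ (λ α → fromℕ-∑ Q₂ _))) refl ⟩
      ∑ Q₁ (λ α → ∑ Q₂ (λ β → fromℕ (a α ℕ.* b β ℕ.* o σ J α β))) * z σ J
        ≈⟨ trans (*-distribʳ-∑ Q₁ (z σ J) _) (∑-cong Q₁ (λ α → *-distribʳ-∑ Q₂ (z σ J) _)) ⟩
      ∑ Q₁ (λ α → ∑ Q₂ (λ β → fromℕ (a α ℕ.* b β ℕ.* o σ J α β) * z σ J))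
        ≈⟨ ∑-cong Q₁ (λ α → ∑-cong Q₂ (λ β → trans (*-cong (trans (fromℕ-* (a α ℕ.* b β) _) (*-cong (fromℕ-* (a α) (b β)) refl)) refl)
                                                    (trans (*-assoc _ _ _) (*-assoc _ _ _)))) ⟩
      ∑ Q₁ (λ α → ∑ Q₂ (λ β → t σ J α β)) ∎

module Inversion {c ℓ} (R : CommutativeRing c ℓ) where
  open import Data.Nat as ℕ using (ℕ; zero; suc)
  import Data.Nat.Properties as ℕ
  open import Data.Product using (_×_; _,_)
  open import Data.Sum using (inj₁; inj₂)
  open import Data.Empty using (⊥-elim)
  import Data.List
  open import Data.Vec using (Vec; sum)
  import Data.Vec.Properties as Vec
  open import Relation.Nullary using (Dec; yes; no)
  import Relation.Binary.PropositionalEquality as P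
  open import Defs using (comps; cIJ; IsComp; module FQSymN)
  open Indicator using (δⱽ; 𝟙-yes; 𝟙-no)
  open Enumeration using (comps-sound; ∑-comps-δⱽ; δⱽ≢0⇒≡)
  open Unitriangular

  open CommutativeRing R
  open FQSymN R using (fromℕ)
  open ListSum commutativeSemiring
  open Coefficients R using (module ℕΣ; ∑-select; fromℕ-1)
  open import Relation.Binary.Reasoning.Setoid setoid
  open import Algebra.Properties.Ring ring using (-0#≈0#; x[y-z]≈xy-xz)
  open import Algebra.Properties.Group +-group using (x∙y⁻¹≈ε⇒x≈y)
  open import Algebra.Properties.AbelianGroup +-abelianGroup using (⁻¹-∙-comm)

  module _ (k d : ℕ) (e : Vec ℕ k → Carrier)
           (∑ce≈0 : ∀ I → IsComp I → sum I P.≡ d → ∑ (comps k d) (λ J → fromℕ (cIJ I J) * e J) ≈ 0#) where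

    private
      bound = suc k ℕ.* d

      vanishes-if-above-vanishes : ∀ J → IsComp J → sum J P.≡ d →
        (∀ J′ → IsComp J′ → sum J′ P.≡ d → potential 0 J ℕ.< potential 0 J′ → e J′ ≈ 0#) → e J ≈ 0#
      vanishes-if-above-vanishes J cJ |J|≡d above = begin
        e J                                                   ≈⟨ *-identityˡ (e J) ⟨
        1# * e J                                              ≈⟨ *-cong (trans (reflexive (P.cong fromℕ (∑-comps-δⱽ k d J cJ |J|≡d))) fromℕ-1) refl ⟨
        fromℕ (ℕΣ.∑ (comps k d) (λ J′ → δⱽ J′ J)) * e J        ≈⟨ ∑-select (comps k d) (λ J′ → δⱽ J′ J) e J (λ J′ ≢0 → reflexive (P.cong e (δⱽ≢0⇒≡ J′ J ≢0))) ⟨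
        ∑ (comps k d) (λ J′ → fromℕ (δⱽ J′ J) * e J′)          ≈⟨ ∑-cong-All (comps k d) (comps-sound k d) δ≈c ⟩
        ∑ (comps k d) (λ J′ → fromℕ (cIJ J J′) * e J′)         ≈⟨ ∑ce≈0 J cJ |J|≡d ⟩
        0#                                                    ∎
        where
        δ≈c : ∀ J′ → IsComp J′ × sum J′ P.≡ d → fromℕ (δⱽ J′ J) * e J′ ≈ fromℕ (cIJ J J′) * e J′
        δ≈c J′ (cJ′ , |J′|≡d) = by-cases (Vec.≡-dec ℕ._≟_ J′ J)
          where
          by-cases : Dec (J′ P.≡ J) → fromℕ (δⱽ J′ J) * e J′ ≈ fromℕ (cIJ J J′) * e J′
          by-cases (yes P.refl) =
            *-cong (reflexive (P.cong fromℕ (P.trans (𝟙-yes (Vec.≡-dec ℕ._≟_ J J) P.refl) (P.sym (cAux-diagonal 0 J cJ))))) refl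
          by-cases (no J′≢J) with cIJ J J′ ℕ.≟ 0
          ... | yes c≡0 = trans (*-cong (reflexive (P.cong fromℕ (𝟙-no (Vec.≡-dec ℕ._≟_ J′ J) J′≢J))) refl)
                            (trans (zeroˡ _) (sym (trans (*-cong (reflexive (P.cong fromℕ c≡0)) refl) (zeroˡ _))))
          ... | no  c≢0 with cAux≢0⇒≡⊎potential< J J′ 0 0 cJ′ ℕ.z≤n (P.trans |J|≡d (P.sym |J′|≡d)) c≢0
          ...   | inj₁ (_ , J≡J′) = ⊥-elim (J′≢J (P.sym J≡J′))
          ...   | inj₂ J<J′ = trans (*-cong refl e≈0) (trans (zeroʳ _) (sym (trans (*-cong refl e≈0) (zeroʳ _))))
            where e≈0 = above J′ cJ′ |J′|≡d J<J′

      -- Downward induction on the potential, which is at most (k + 1) d.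
      vanishes-above : ∀ t J → IsComp J → sum J P.≡ d → bound ℕ.≤ potential 0 J ℕ.+ t → e J ≈ 0#
      vanishes-above zero J cJ |J|≡d B≤ = vanishes-if-above-vanishes J cJ |J|≡d (λ J′ cJ′ |J′|≡d J<J′ →
        ⊥-elim (ℕ.<-irrefl P.refl (ℕ.<-≤-trans (ℕ.≤-<-trans (ℕ.≤-trans B≤ (ℕ.≤-reflexive (ℕ.+-identityʳ _))) J<J′)
          (ℕ.≤-trans (potential≤ 0 J′) (ℕ.≤-reflexive (P.cong (suc k ℕ.*_) |J′|≡d))))))
      vanishes-above (suc t) J cJ |J|≡d B≤ = vanishes-if-above-vanishes J cJ |J|≡d (λ J′ cJ′ |J′|≡d J<J′ →
        vanishes-above t J′ cJ′ |J′|≡d (ℕ.≤-trans B≤ (ℕ.≤-trans (ℕ.≤-reflexive (ℕ.+-suc (potential 0 J) t)) (ℕ.+-monoˡ-≤ t J<J′))))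

    cIJ-transform-kernel : ∀ J → IsComp J → sum J P.≡ d → e J ≈ 0#
    cIJ-transform-kernel J cJ |J|≡d = vanishes-above bound J cJ |J|≡d (ℕ.m≤n+m bound (potential 0 J))

  ∑-neg : ∀ {A : Set} (xs : Data.List.List A) (g : A → Carrier) → ∑ xs (λ x → - g x) ≈ - ∑ xs g
  ∑-neg Data.List.[]       g = sym -0#≈0#
  ∑-neg (x Data.List.∷ xs) g = trans (+-cong refl (∑-neg xs g)) (⁻¹-∙-comm (g x) (∑ xs g))

  cIJ-transform-injective : ∀ k d (e e′ : Vec ℕ k → Carrier) →
    (∀ I → IsComp I → sum I P.≡ d → ∑ (comps k d) (λ J → fromℕ (cIJ I J) * e J) ≈ ∑ (comps k d) (λ J → fromℕ (cIJ I J) * e′ J)) →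
    ∀ J → IsComp J → sum J P.≡ d → e J ≈ e′ J
  cIJ-transform-injective k d e e′ ∑ce≈∑ce′ J cJ |J|≡d =
    x∙y⁻¹≈ε⇒x≈y (e J) (e′ J) (cIJ-transform-kernel k d (λ J → e J - e′ J) ∑c[e-e′]≈0 J cJ |J|≡d)
    where
    ∑c[e-e′]≈0 : ∀ I → IsComp I → sum I P.≡ d → ∑ (comps k d) (λ J → fromℕ (cIJ I J) * (e J - e′ J)) ≈ 0#
    ∑c[e-e′]≈0 I cI |I|≡d = begin
      ∑ Cs (λ J → fromℕ (cIJ I J) * (e J - e′ J))                 ≈⟨ ∑-cong Cs (λ J → x[y-z]≈xy-xz (fromℕ (cIJ I J)) (e J) (e′ J)) ⟩
      ∑ Cs (λ J → fromℕ (cIJ I J) * e J - fromℕ (cIJ I J) * e′ J)  ≈⟨ ∑-+ Cs _ _ ⟩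
      ∑ Cs (λ J → fromℕ (cIJ I J) * e J) + ∑ Cs (λ J → - (fromℕ (cIJ I J) * e′ J))
                                                                  ≈⟨ +-cong (∑ce≈∑ce′ I cI |I|≡d) (∑-neg Cs _) ⟩
      ∑ Cs (λ J → fromℕ (cIJ I J) * e′ J) - ∑ Cs (λ J → fromℕ (cIJ I J) * e′ J)
                                                                  ≈⟨ -‿inverseʳ _ ⟩
      0#                                                          ∎
      where Cs = comps k d

module ProductRule {c ℓ} (R : CommutativeRing c ℓ) where
  open import Data.Nat as ℕ using (ℕ)
  import Data.Nat.Properties as ℕ
  open import Data.Fin using (Fin)
  open import Data.List using ([]; _∷_; length)
  open import Data.Product using (_×_; _,_)
  open import Data.Vec using (Vec; []; _∷_; sum)
  open import Data.Vec.Relation.Unary.All as All using (All)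
  import Data.Vec.Relation.Unary.All.Properties as AllV
  import Relation.Binary.PropositionalEquality as P
  open import Defs using (ColWord; shuffles; occ; eps; comps; perms; cIJ; IsComp; IsPerm; letters; shiftLetters; module FQSymN)
  open Indicator using (δⱽ)
  open Readings using (readings)
  open Parse using (colored; readings-eps; ∑-shuffles-colored)
  open Enumeration using (∑-perms-δⱽ; comps-sound; δⱽ≢0⇒≡; letters-injective)
  open Decode using (ColoredPermutation; shuffle-coloredPermutation; length-colored)

  open CommutativeRing R
  open FQSymN R
  open ListSum commutativeSemiring
  open Coefficients R
  open Inversion R using (cIJ-transform-injective)
  open import Relation.Binary.Reasoning.Setoid setoid

  FExpansion : ((n : ℕ) → Vec (Fin n) n → Vec ℕ n → Elem) → Set ℓ
  FExpansion Z = ∀ n (σ : Vec (Fin n) n) (I : Vec ℕ n) → IsPerm σ → IsComp I →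
                 F σ I ≋ Σ-list (comps n (sum I)) (λ J → scale (fromℕ (cIJ I J)) (Z n σ J))

  letters-positive : ∀ {N} (σ : Vec (Fin N) N) → All (1 ℕ.≤_) (letters σ)
  letters-positive σ = AllV.map⁺ (All.universal (λ _ → ℕ.s≤s ℕ.z≤n) σ)

  shiftLetters-positive : ∀ {k} n (ls : Vec ℕ k) → All (1 ℕ.≤_) ls → All (1 ℕ.≤_) (shiftLetters n ls)
  shiftLetters-positive n ls 1≤ls = AllV.map⁺ (All.map (λ 1≤l → ℕ.≤-trans 1≤l (ℕ.m≤m+n _ n)) 1≤ls)

  shiftCol-colored : ∀ {k} n (ls I : Vec ℕ k) → shiftCol n (colored ls I) P.≡ colored (shiftLetters n ls) I
  shiftCol-colored n []       []      = P.refl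
  shiftCol-colored n (l ∷ ls) (i ∷ I) = P.cong ((l ℕ.+ n , i) ∷_) (shiftCol-colored n ls I)

  module _ (Z : (n : ℕ) → Vec (Fin n) n → Vec ℕ n → Elem) (expand : FExpansion Z) where

    coeff-F : ∀ {N d} (τ : Vec (Fin N) N) (I : Vec ℕ N) → IsPerm τ → IsComp I → sum I P.≡ d → ∀ w →
              coeff (F τ I) w ≈ ∑ (comps N d) (λ J → fromℕ (cIJ I J) * coeff (Z N τ J) w)
    coeff-F {N} τ I pτ cI P.refl w = begin
      coeff (F τ I) w
        ≈⟨ expand N τ I pτ cI w ⟩
      coeff (Σ-list (comps N (sum I)) (λ J → scale (fromℕ (cIJ I J)) (Z N τ J))) w
        ≈⟨ coeff-Σ-list (comps N (sum I)) _ w ⟩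
      ∑ (comps N (sum I)) (λ J → coeff (scale (fromℕ (cIJ I J)) (Z N τ J)) w)
        ≈⟨ ∑-cong (comps N (sum I)) (λ J → coeff-scale (fromℕ (cIJ I J)) (Z N τ J) w) ⟩
      ∑ (comps N (sum I)) (λ J → fromℕ (cIJ I J) * coeff (Z N τ J) w) ∎

    -- u is F_{τ,I} = ∑_J c_IJ Z_{τ,J}, and readings (ε_{σ,J}) u 0 is c_IJ if σ = τ and 0 otherwise.
    δᴿ-coloredPermutation : ∀ {N d} u → ColoredPermutation N d u → ∀ w →
      δᴿ u w ≈ ∑ (perms N) (λ σ → ∑ (comps N d) (λ J → fromℕ (readings (eps (letters σ) J) u 0) * coeff (Z N σ J) w))
    δᴿ-coloredPermutation {N} {d} u (τ , I , P.refl , pτ , cI , |I|≡d) w = begin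
      δᴿ u w
        ≈⟨ trans (coeff≈⟪δᴿ⟫ (F τ I) w) (trans (+-identityʳ _) (*-identityˡ _)) ⟨
      coeff (F τ I) w
        ≈⟨ coeff-F τ I pτ cI |I|≡d w ⟩
      h τ
        ≈⟨ *-identityˡ (h τ) ⟨
      1# * h τ
        ≈⟨ *-cong (trans (reflexive (P.cong fromℕ (∑-perms-δⱽ N τ pτ))) fromℕ-1) refl ⟨
      fromℕ (ℕΣ.∑ (perms N) (λ σ → δⱽ (letters σ) (letters τ))) * h τ
        ≈⟨ ∑-select (perms N) _ h τ (λ σ ≢0 → reflexive (P.cong h (letters-injective σ τ (δⱽ≢0⇒≡ _ _ ≢0)))) ⟨
      ∑ (perms N) (λ σ → fromℕ (δⱽ (letters σ) (letters τ)) * h σ)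
        ≈⟨ ∑-cong (perms N) (λ σ → trans (*-distribˡ-∑ (comps N d) _ _) (∑-cong-All (comps N d) (comps-sound N d) (term σ))) ⟩
      ∑ (perms N) (λ σ → ∑ (comps N d) (λ J → fromℕ (readings (eps (letters σ) J) u 0) * z σ J)) ∎
      where
      z : Vec (Fin N) N → Vec ℕ N → Carrier
      z σ J = coeff (Z N σ J) w
      h : Vec (Fin N) N → Carrier
      h σ = ∑ (comps N d) (λ J → fromℕ (cIJ I J) * z σ J)
      term : ∀ σ J → IsComp J × sum J P.≡ d →
             fromℕ (δⱽ (letters σ) (letters τ)) * (fromℕ (cIJ I J) * z σ J) ≈ fromℕ (readings (eps (letters σ) J) u 0) * z σ J
      term σ J (cJ , |J|≡d) = begin
        fromℕ (δⱽ (letters σ) (letters τ)) * (fromℕ (cIJ I J) * z σ J)    ≈⟨ *-assoc _ _ _ ⟨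
        fromℕ (δⱽ (letters σ) (letters τ)) * fromℕ (cIJ I J) * z σ J      ≈⟨ *-cong (fromℕ-* (δⱽ (letters σ) (letters τ)) (cIJ I J)) refl ⟨
        fromℕ (δⱽ (letters σ) (letters τ) ℕ.* cIJ I J) * z σ J            ≈⟨ *-cong (reflexive (P.cong fromℕ (P.sym
            (readings-eps N (letters σ) (letters τ) I J (letters-positive σ) cI cJ 0 0 (P.trans |I|≡d (P.sym |J|≡d)))))) refl ⟩
        fromℕ (readings (eps (letters σ) J) u 0) * z σ J                  ∎

    module _ {n m} (σ′ : Vec (Fin n) n) (σ″ : Vec (Fin m) m) (pσ′ : IsPerm σ′) (pσ″ : IsPerm σ″)
             (d₁ d₂ : ℕ) (w : ColWord) where

      private
        N = n ℕ.+ m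
        d = d₁ ℕ.+ d₂
        C₁ = comps n d₁
        C₂ = comps m d₂
        ls₁ = letters σ′
        ls₂ = shiftLetters n (letters σ″)
        z : Vec (Fin N) N → Vec ℕ N → Carrier
        z σ J = coeff (Z N σ J) w
        occurrences : Vec (Fin N) N → Vec ℕ N → Vec ℕ n → Vec ℕ m → ℕ
        occurrences σ J A B = occ (eps (letters σ) J) (shuffles (eps ls₁ A) (eps ls₂ B))
        product : Vec ℕ n → Vec ℕ m → Elem
        product A B = Σ-list (perms N) (λ σ → Σ-list (comps N d) (λ J → scale (fromℕ (occurrences σ J A B)) (Z N σ J)))
        transform : (Vec ℕ n → Vec ℕ m → Carrier) → Vec ℕ n → Vec ℕ m → Carrier
        transform x I₁ I₂ = ∑ C₁ (λ A → fromℕ (cIJ I₁ A) * ∑ C₂ (λ B → fromℕ (cIJ I₂ B) * x A B))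

        coeff-product : ∀ A B → coeff (product A B) w ≈ ∑ (perms N) (λ σ → ∑ (comps N d) (λ J → fromℕ (occurrences σ J A B) * z σ J))
        coeff-product A B = trans (coeff-Σ-list (perms N) _ w) (∑-cong (perms N) (λ σ →
          trans (coeff-Σ-list (comps N d) _ w) (∑-cong (comps N d) (λ J → coeff-scale _ (Z N σ J) w))))

        F⋆F≈transform-product : ∀ I₁ I₂ → IsComp I₁ → IsComp I₂ → sum I₁ P.≡ d₁ → sum I₂ P.≡ d₂ →
          coeff (F σ′ I₁ ⋆ F σ″ I₂) w ≈ transform (λ A B → coeff (product A B) w) I₁ I₂
        F⋆F≈transform-product I₁ I₂ cI₁ cI₂ P.refl P.refl = begin
          coeff (F σ′ I₁ ⋆ F σ″ I₂) w
            ≈⟨ coeff-single⋆single (colWord σ′ I₁) (colWord σ″ I₂) w ⟩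
          shuffleCount w (colWord σ′ I₁) (colWord σ″ I₂)
            ≡⟨ P.cong (λ S → ∑ S (λ u → δᴿ u w)) shuffles≡ ⟩
          ∑ S (λ u → δᴿ u w)
            ≈⟨ ∑-cong-All S (shuffle-coloredPermutation n m σ′ σ″ I₁ I₂ pσ′ pσ″ cI₁ cI₂) (λ u cp → δᴿ-coloredPermutation u cp w) ⟩
          ∑ S (λ u → ∑ (perms N) (λ σ → ∑ (comps N d) (λ J → fromℕ (readings (eps (letters σ) J) u 0) * z σ J)))
            ≈⟨ ∑-comm₂ (perms N) (comps N d) S _ ⟨
          ∑ (perms N) (λ σ → ∑ (comps N d) (λ J → ∑ S (λ u → fromℕ (readings (eps (letters σ) J) u 0) * z σ J)))
            ≈⟨ ∑-cong (perms N) (λ σ → ∑-cong (comps N d) (λ J →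
                 trans (sym (*-distribʳ-∑ S (z σ J) _)) (*-cong (sym (fromℕ-∑ S _)) refl))) ⟩
          ∑ (perms N) (λ σ → ∑ (comps N d) (λ J → fromℕ (ℕΣ.∑ S (λ u → readings (eps (letters σ) J) u 0)) * z σ J))
            ≈⟨ ∑-cong (perms N) (λ σ → ∑-cong (comps N d) (λ J → *-cong (reflexive (P.cong fromℕ
                 (∑-shuffles-colored n m ls₁ I₁ ls₂ I₂ (letters-positive σ′) cI₁
                    (shiftLetters-positive n (letters σ″) (letters-positive σ″)) cI₂ (eps (letters σ) J)))) refl)) ⟩
          ∑ (perms N) (λ σ → ∑ (comps N d) (λ J →
            fromℕ (ℕΣ.∑ C₁ (λ A → ℕΣ.∑ C₂ (λ B → cIJ I₁ A ℕ.* cIJ I₂ B ℕ.* occurrences σ J A B))) * z σ J))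
            ≈⟨ fromℕ-∑∑-reorder (perms N) (comps N d) C₁ C₂ (cIJ I₁) (cIJ I₂) occurrences z ⟩
          transform (λ A B → ∑ (perms N) (λ σ → ∑ (comps N d) (λ J → fromℕ (occurrences σ J A B) * z σ J))) I₁ I₂
            ≈⟨ ∑-cong C₁ (λ A → *-cong refl (∑-cong C₂ (λ B → *-cong refl (coeff-product A B)))) ⟨
          transform (λ A B → coeff (product A B) w) I₁ I₂ ∎
          where
          S = shuffles (colored ls₁ I₁) (colored ls₂ I₂)
          shuffles≡ : shuffles (colWord σ′ I₁) (shiftCol (length (colWord σ′ I₁)) (colWord σ″ I₂)) P.≡ S
          shuffles≡ = P.cong (shuffles (colored ls₁ I₁))
            (P.trans (P.cong (λ k → shiftCol k (colWord σ″ I₂)) (length-colored ls₁ I₁)) (shiftCol-colored n (letters σ″) I₂))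

        F⋆F≈transform-Z⋆Z : ∀ I₁ I₂ → IsComp I₁ → IsComp I₂ → sum I₁ P.≡ d₁ → sum I₂ P.≡ d₂ →
          coeff (F σ′ I₁ ⋆ F σ″ I₂) w ≈ transform (λ A B → coeff (Z n σ′ A ⋆ Z m σ″ B) w) I₁ I₂
        F⋆F≈transform-Z⋆Z I₁ I₂ cI₁ cI₂ P.refl P.refl = begin
          coeff (F σ′ I₁ ⋆ F σ″ I₂) w
            ≈⟨ ⋆-cong {F σ′ I₁} {ΣZ₁} {F σ″ I₂} {ΣZ₂} (expand n σ′ I₁ pσ′ cI₁) (expand m σ″ I₂ pσ″ cI₂) w ⟩
          coeff (Σ-list C₁ (λ A → scale (fromℕ (cIJ I₁ A)) (Z n σ′ A)) ⋆ Σ-list C₂ (λ B → scale (fromℕ (cIJ I₂ B)) (Z m σ″ B))) w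
            ≈⟨ coeff-Σ⋆ C₁ (λ A → fromℕ (cIJ I₁ A)) (Z n σ′) (Σ-list C₂ (λ B → scale (fromℕ (cIJ I₂ B)) (Z m σ″ B))) w ⟩
          ∑ C₁ (λ A → fromℕ (cIJ I₁ A) * coeff (Z n σ′ A ⋆ Σ-list C₂ (λ B → scale (fromℕ (cIJ I₂ B)) (Z m σ″ B))) w)
            ≈⟨ ∑-cong C₁ (λ A → *-cong refl (coeff-⋆Σ (Z n σ′ A) C₂ _ (Z m σ″) w)) ⟩
          transform (λ A B → coeff (Z n σ′ A ⋆ Z m σ″ B) w) I₁ I₂ ∎
          where
          ΣZ₁ = Σ-list C₁ (λ A → scale (fromℕ (cIJ I₁ A)) (Z n σ′ A))
          ΣZ₂ = Σ-list C₂ (λ B → scale (fromℕ (cIJ I₂ B)) (Z m σ″ B))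

      Z⋆Z≈product : ∀ A B → IsComp A → IsComp B → sum A P.≡ d₁ → sum B P.≡ d₂ →
                    coeff (Z n σ′ A ⋆ Z m σ″ B) w ≈ coeff (product A B) w
      Z⋆Z≈product A B cA cB |A|≡d₁ |B|≡d₂ =
        cIJ-transform-injective m d₂ (x A) (r A) (λ I₂ cI₂ |I₂|≡d₂ →
          cIJ-transform-injective n d₁ (λ A′ → ∑ C₂ (λ B′ → fromℕ (cIJ I₂ B′) * x A′ B′))
                                       (λ A′ → ∑ C₂ (λ B′ → fromℕ (cIJ I₂ B′) * r A′ B′))
            (λ I₁ cI₁ |I₁|≡d₁ → trans (sym (F⋆F≈transform-Z⋆Z I₁ I₂ cI₁ cI₂ |I₁|≡d₁ |I₂|≡d₂))
                                        (F⋆F≈transform-product I₁ I₂ cI₁ cI₂ |I₁|≡d₁ |I₂|≡d₂))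
            A cA |A|≡d₁)
          B cB |B|≡d₂
        where
        x r : Vec ℕ n → Vec ℕ m → Carrier
        x A B = coeff (Z n σ′ A ⋆ Z m σ″ B) w
        r A B = coeff (product A B) w

  Z-product : (Z : (n : ℕ) → Vec (Fin n) n → Vec ℕ n → Elem) → FExpansion Z →
    ∀ n m (σ′ : Vec (Fin n) n) (σ″ : Vec (Fin m) m) (J′ : Vec ℕ n) (J″ : Vec ℕ m) →
    IsPerm σ′ → IsPerm σ″ → IsComp J′ → IsComp J″ →
    (Z n σ′ J′ ⋆ Z m σ″ J″)
      ≋ Σ-list (perms (n ℕ.+ m)) (λ σ →
          Σ-list (comps (n ℕ.+ m) (sum J′ ℕ.+ sum J″)) (λ J →
            scale (fromℕ (occ (eps (letters σ) J) (shuffles (eps (letters σ′) J′) (eps (shiftLetters n (letters σ″)) J″))))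
                  (Z (n ℕ.+ m) σ J)))
  Z-product Z expand n m σ′ σ″ J′ J″ pσ′ pσ″ cJ′ cJ″ w =
    Z⋆Z≈product Z expand σ′ σ″ pσ′ pσ″ (sum J′) (sum J″) w J′ J″ cJ′ cJ″ P.refl P.refl

open import Defs
open import Data.Nat using (ℕ; _+_)
open import Data.Fin using (Fin)
open import Data.Vec using (Vec; sum)

mainTheorem9 : ∀ {c ℓ} (K : Field c ℓ) →
    let open FQSymN (Field.commutativeRing K) in
    IsCharZero →
    (Z : (n : ℕ) → Vec (Fin n) n → Vec ℕ n → Elem) →
    (∀ n (σ : Vec (Fin n) n) (I : Vec ℕ n) → IsPerm σ → IsComp I →
       F σ I ≋ Σ-list (comps n (sum I)) (λ J → scale (fromℕ (cIJ I J)) (Z n σ J))) →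
    ∀ n m (σ' : Vec (Fin n) n) (σ'' : Vec (Fin m) m) (J' : Vec ℕ n) (J'' : Vec ℕ m) →
    IsPerm σ' → IsPerm σ'' → IsComp J' → IsComp J'' →
    (Z n σ' J' ⋆ Z m σ'' J'')
      ≋ Σ-list (perms (n + m)) (λ σ →
          Σ-list (comps (n + m) (sum J' + sum J'')) (λ J →
            scale (fromℕ (occ (eps (letters σ) J)
                                (shuffles (eps (letters σ') J')
                                          (eps (shiftLetters n (letters σ'')) J''))))
                  (Z (n + m) σ J)))
mainTheorem9 K _ = ProductRule.Z-product (Field.commutativeRing K)
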